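{- Let $p$ be a prime and $\Gamma$ a congruence subgroup of $\mathrm{SL}_2(\mathbb{Z})$ of level a power of $p$, containing $-I$ and having at most two cusps. Then $|G_2|\ge(p^4-p^2)/2$ and $V_1\ne\{0\}$. If moreover $[\mathrm{SL}_2(\mathbb{F}_p):G_1]>2$, then $\dim V_1\ge2$.
   Context: For $s\ge1$, $G_s$ is the image of $\Gamma$ in $\mathrm{SL}_2(\mathbb{Z}/p^s\mathbb{Z})$, and $K_{s+1}$ the kernel of the reduction map $G_{s+1}\to G_s$. With $\exp_{1,s}:\mathfrak{sl}_2(\mathbb{F}_p)\to\mathrm{SL}_2(\mathbb{Z}/p^{s+1}\mathbb{Z})$, $A\mapsto I+p^s\widetilde A$ ($\widetilde A$ any lift), $V_s=\exp_{1,s}^{ -1}(K_{s+1})$ is an $\mathbb{F}_p$-subspace of the space $\mathfrak{sl}_2(\mathbb{F}_p)$ of traceless matrices. The number of cusps of $\Gamma$ is the number of $\Gamma$-orbits on $\mathbb{P}^1(\mathbb{Q})$. -}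

module Defs where

open import Data.Nat as ℕ using (ℕ; _^_)
open import Data.Nat.Primality using (Prime)
open import Data.Fin using (Fin)
open import Data.Integer using (ℤ; +_; _+_; _-_; _*_; -_; 0ℤ; 1ℤ)
open import Data.Integer.Divisibility using (_∣_)
open import Data.Integer.GCD using (gcd)
open import Data.Product using (Σ; ∃; _×_; _,_)
open import Data.Sum using (_⊎_)
open import Relation.Nullary using (¬_)
open import Relation.Binary.PropositionalEquality using (_≡_; _≢_)

record Mat : Set where
  constructor mat
  field
    a b c d : ℤ
open Mat public

I₂ : Mat
I₂ = mat 1ℤ 0ℤ 0ℤ 1ℤ

-I₂ : Mat
-I₂ = mat (- 1ℤ) 0ℤ 0ℤ (- 1ℤ)

_·_ : Mat → Mat → Mat
mat a₁ b₁ c₁ d₁ · mat a₂ b₂ c₂ d₂ =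
  mat (a₁ * a₂ + b₁ * c₂) (a₁ * b₂ + b₁ * d₂)
      (c₁ * a₂ + d₁ * c₂) (c₁ * b₂ + d₁ * d₂)

det : Mat → ℤ
det (mat a b c d) = a * d - b * c

tr : Mat → ℤ
tr (mat a b c d) = a + d

-- adjugate; equals the inverse for matrices of determinant 1
adj : Mat → Mat
adj (mat a b c d) = mat d (- b) (- c) a

_⋆_ : ℤ → Mat → Mat
k ⋆ mat a b c d = mat (k * a) (k * b) (k * c) (k * d)

_⊕_ : Mat → Mat → Mat
mat a₁ b₁ c₁ d₁ ⊕ mat a₂ b₂ c₂ d₂ = mat (a₁ + a₂) (b₁ + b₂) (c₁ + c₂) (d₁ + d₂)

SL2Z : Mat → Set
SL2Z g = det g ≡ 1ℤ

_≡[_]_ : ℤ → ℕ → ℤ → Set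
x ≡[ n ] y = (+ n) ∣ (x - y)

_≡ₘ[_]_ : Mat → ℕ → Mat → Set
g ≡ₘ[ n ] h = (a g ≡[ n ] a h) × (b g ≡[ n ] b h)
            × (c g ≡[ n ] c h) × (d g ≡[ n ] d h)

record IsSubgroupSL2 (Γ : Mat → Set) : Set where
  field
    ⊆SL2   : ∀ g → Γ g → SL2Z g
    has-I  : Γ I₂
    mul    : ∀ g h → Γ g → Γ h → Γ (g · h)
    inv    : ∀ g → Γ g → Γ (adj g)

ContainsΓ : ℕ → (Mat → Set) → Set
ContainsΓ N Γ = ∀ g → SL2Z g → g ≡ₘ[ N ] I₂ → Γ g

-- congruence subgroup whose level is a power of p
-- (level N = least N with Γ(N) ⊆ Γ; it is a power of p iff Γ(p^k) ⊆ Γ for some k)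
CongruenceOfPLevel : ℕ → (Mat → Set) → Set
CongruenceOfPLevel p Γ = IsSubgroupSL2 Γ × ∃ λ k → ContainsΓ (p ^ k) Γ

-- P¹(ℚ): primitive integer pairs (x : y), with (x,y) ~ (-x,-y)
record Cusp : Set where
  constructor cusp
  field
    num den : ℤ
    prim    : gcd num den ≡ 1ℤ
open Cusp public

act : Mat → ℤ → ℤ → ℤ × ℤ
act (mat a b c d) x y = (a * x + b * y , c * x + d * y)

CuspEquiv : (Mat → Set) → Cusp → Cusp → Set
CuspEquiv Γ u v = ∃ λ g → Γ g ×
  ( (act g (num u) (den u) ≡ (num v , den v))
  ⊎ (act g (num u) (den u) ≡ (- num v , - den v)))

AtMostTwoCusps : (Mat → Set) → Set
AtMostTwoCusps Γ = ∃ λ u₁ → ∃ λ u₂ → ∀ v → CuspEquiv Γ v u₁ ⊎ CuspEquiv Γ v u₂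

-- membership in G_s = image of Γ in SL₂(ℤ/p^s), for integer representatives
InG : ℕ → (Mat → Set) → ℕ → Mat → Set
InG p Γ s x = ∃ λ g → Γ g × (g ≡ₘ[ p ^ s ] x)

CardGAtLeast : ℕ → (Mat → Set) → ℕ → ℕ → Set
CardGAtLeast p Γ s m = Σ (Fin m → Mat) λ f →
  (∀ i → InG p Γ s (f i)) × (∀ i j → f i ≡ₘ[ p ^ s ] f j → i ≡ j)

-- A (integer representative of an element of sl₂(𝔽_p)) lies in V_s:
-- A traceless mod p and I + p^s A ∈ K_{s+1} (i.e. in G_{s+1})
InV : ℕ → (Mat → Set) → ℕ → Mat → Set
InV p Γ s A = (tr A ≡[ p ] 0ℤ) × InG p Γ (ℕ.suc s) (I₂ ⊕ ((+ (p ^ s)) ⋆ A))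

zeroM : Mat
zeroM = mat 0ℤ 0ℤ 0ℤ 0ℤ

VNonzero : ℕ → (Mat → Set) → ℕ → Set
VNonzero p Γ s = ∃ λ A → InV p Γ s A × ¬ (A ≡ₘ[ p ] zeroM)

DimVAtLeast2 : ℕ → (Mat → Set) → ℕ → Set
DimVAtLeast2 p Γ s = ∃ λ A → ∃ λ B → InV p Γ s A × InV p Γ s B ×
  (∀ (x y : ℤ) → ((x ⋆ A) ⊕ (y ⋆ B)) ≡ₘ[ p ] zeroM →
      (x ≡[ p ] 0ℤ) × (y ≡[ p ] 0ℤ))

-- [SL₂(𝔽_p) : G₁] > 2 : three elements of SL₂(𝔽_p) in pairwise distinct
-- left cosets of G₁  (x⁻¹ = adj x modulo p, as det x ≡ 1 mod p)
IndexG1GreaterThan2 : ℕ → (Mat → Set) → Set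
IndexG1GreaterThan2 p Γ = ∃ λ x → ∃ λ y → ∃ λ z →
  (det x ≡[ p ] 1ℤ) × (det y ≡[ p ] 1ℤ) × (det z ≡[ p ] 1ℤ) ×
  ¬ InG p Γ 1 (adj x · y) × ¬ InG p Γ 1 (adj x · z) × ¬ InG p Γ 1 (adj y · z)

{-# OPTIONS --safe #-}
module Submission where

open import Data.Empty using (⊥-elim)
open import Data.Fin as Fin using (Fin; zero; suc; toℕ; fromℕ<; combine; punchOut)
import Data.Fin.Properties as Fin
open import Data.Integer as ℤ using (ℤ; +_; +[1+_]; -[1+_]; _+_; _-_; _*_; -_; 0ℤ; 1ℤ; ∣_∣; _%ℕ_; _/ℕ_)
open import Data.Integer.DivMod using (n%ℕd<d; a≡a%ℕn+[a/ℕn]*n)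
import Data.Integer.Divisibility.Signed as Signed
import Data.Integer.GCD as ℤ
import Data.Integer.Properties as ℤ
open import Data.Integer.Tactic.RingSolver using (solve-∀)
open import Data.Nat as ℕ using (ℕ; suc; NonZero; _^_; _∸_; _/_; _≤_; _<_)
open import Data.Nat.Coprimality using (Coprime; coprime-Bézout)
open import Data.Nat.DivMod using (m/n*n≤m; m≡m%n+[m/n]*n; m%n<n)
import Data.Nat.Divisibility as ℕ
open import Data.Nat.GCD using (module Bézout)
open import Data.Nat.Primality using (Prime; prime⇒irreducible; prime⇒nonZero; prime⇒nonTrivial; ¬prime[0]; ¬prime[1])
import Data.Nat.Properties as ℕ
import Data.Nat.Tactic.RingSolver as ℕ
open import Data.Product using (Σ; ∃; ∃₂; _×_; _,_; proj₁; proj₂; uncurry)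
open import Data.Product.Function.NonDependent.Propositional using (_×-↔_)
open import Data.Sum using (_⊎_; inj₁; inj₂)
open import Data.Sum.Function.Propositional using (_⊎-↔_)
open import Function using (_∘_)
open import Function.Bundles using (Injection; _↣_; _↔_; mk↣)
open import Function.Construct.Composition using (_↣-∘_; _↔-∘_)
open import Function.Construct.Identity using (↔-id)
open import Function.Properties.Inverse using (↔⇒↣)
open import Level using (0ℓ)
open import Relation.Binary.Bundles using (Setoid)
open import Relation.Binary.PropositionalEquality hiding ([_])
import Relation.Binary.Reasoning.Setoid as SetoidReasoning
open import Relation.Nullary using (¬_; Dec; yes; no; map′; _×-dec_)
open import Relation.Unary using (Pred; Decidable)

open import Defs

-- Lifting the p⁴ - p² vectors of (ℤ/p²)² that are nonzero mod p to primitive integer vectors gives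
-- cusps pairwise distinct mod p². Since -I ∈ Γ, a cusp equivalent to u is sent onto u itself by some
-- g ∈ Γ; with at most two orbits, half of these cusps are sent onto one u by elements g_t ∈ Γ, and
-- g_s ≡ g_t (mod p²) would force the cusps to agree mod p². So |G₂| ≥ (p⁴ - p²)/2.
-- A determinant-one matrix mod p is determined by three of its entries, so |G₁| ≤ p³. For p ≥ 3 two
-- of the elements above agree mod p, and γ⁻¹γ′ = I + pA with A ≢ 0 (mod p) puts A in V₁; for p = 2,
-- -I = I + 2(-I) does. Given three cosets w_k G₁, the 3 |G₂| > p⁴ products w_k γ_i yield p + 1 that
-- agree mod p; they lie in one coset, so their γ_i agree mod p and give p + 1 elements of V₁ pairwise
-- distinct mod p. A line in 𝔽ₚ⁴ has only p points, so two of them are independent.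

-- Congruences of integers

infix 4 _≈[_]_

record _≈[_]_ (x N y : ℤ) : Set where
  constructor _,_
  field
    quotient : ℤ
    x≡y+qN   : x ≡ y + quotient * N

module _ {N : ℤ} where

  ≈-reflexive : ∀ {x y} → x ≡ y → x ≈[ N ] y
  ≈-reflexive {x} refl = 0ℤ , x≡x+0N x N
    where x≡x+0N : ∀ x N → x ≡ x + 0ℤ * N
          x≡x+0N = solve-∀

  ≈-refl : ∀ {x} → x ≈[ N ] x
  ≈-refl = ≈-reflexive refl

  ≈-sym : ∀ {x y} → x ≈[ N ] y → y ≈[ N ] x
  ≈-sym {y = y} (q , refl) = - q , lemma y q N
    where lemma : ∀ y q N → y ≡ y + q * N + - q * N
          lemma = solve-∀

  ≈-trans : ∀ {x y z} → x ≈[ N ] y → y ≈[ N ] z → x ≈[ N ] z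
  ≈-trans {z = z} (q , refl) (r , refl) = r + q , lemma z q r N
    where lemma : ∀ z q r N → z + r * N + q * N ≡ z + (r + q) * N
          lemma = solve-∀

≈-setoid : ℤ → Setoid 0ℓ 0ℓ
≈-setoid N = record
  { Carrier = ℤ
  ; _≈_ = _≈[ N ]_
  ; isEquivalence = record { refl = ≈-refl ; sym = ≈-sym ; trans = ≈-trans }
  }

module ≈-Reasoning (N : ℤ) = SetoidReasoning (≈-setoid N)

module _ {N : ℤ} where

  +-cong : ∀ {x x′ y y′} → x ≈[ N ] x′ → y ≈[ N ] y′ → x + y ≈[ N ] x′ + y′
  +-cong {x′ = x} {y′ = y} (q , refl) (r , refl) = q + r , lemma x y q r N
    where lemma : ∀ x y q r N → x + q * N + (y + r * N) ≡ x + y + (q + r) * N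
          lemma = solve-∀

  *-cong : ∀ {x x′ y y′} → x ≈[ N ] x′ → y ≈[ N ] y′ → x * y ≈[ N ] x′ * y′
  *-cong {x′ = x} {y′ = y} (q , refl) (r , refl) = q * y + x * r + q * r * N , lemma x y q r N
    where lemma : ∀ x y q r N → (x + q * N) * (y + r * N) ≡ x * y + (q * y + x * r + q * r * N) * N
          lemma = solve-∀

  neg-cong : ∀ {x x′} → x ≈[ N ] x′ → - x ≈[ N ] - x′
  neg-cong {x′ = x} (q , refl) = - q , lemma x q N
    where lemma : ∀ x q N → - (x + q * N) ≡ - x + - q * N
          lemma = solve-∀

  −-cong : ∀ {x x′ y y′} → x ≈[ N ] x′ → y ≈[ N ] y′ → x - y ≈[ N ] x′ - y′
  −-cong x≈x′ y≈y′ = +-cong x≈x′ (neg-cong y≈y′)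

  *N≈0 : ∀ k → k * N ≈[ N ] 0ℤ
  *N≈0 k = k , lemma k N
    where lemma : ∀ k N → k * N ≡ 0ℤ + k * N
          lemma = solve-∀

  −≈0⇒≈ : ∀ {x y} → x - y ≈[ N ] 0ℤ → x ≈[ N ] y
  −≈0⇒≈ {x} {y} x−y≈0 = begin
    x         ≡⟨ lemma x y ⟩
    x - y + y ≈⟨ +-cong x−y≈0 ≈-refl ⟩
    0ℤ + y    ≡⟨ ℤ.+-identityˡ y ⟩
    y         ∎
    where open ≈-Reasoning N
          lemma : ∀ x y → x ≡ x - y + y
          lemma = solve-∀

  ≈⇒−≈0 : ∀ {x y} → x ≈[ N ] y → x - y ≈[ N ] 0ℤ
  ≈⇒−≈0 {y = y} x≈y = ≈-trans (−-cong x≈y (≈-refl {x = y})) (≈-reflexive (ℤ.+-inverseʳ y))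

invertible-cancelˡ : ∀ {N w u x y} → w * u ≈[ N ] 1ℤ → u * x ≈[ N ] u * y → x ≈[ N ] y
invertible-cancelˡ {N} {w} {u} {x} {y} wu≈1 ux≈uy = begin
  x            ≡⟨ ℤ.*-identityˡ x ⟨
  1ℤ * x       ≈⟨ *-cong wu≈1 (≈-refl {x = x}) ⟨
  (w * u) * x  ≡⟨ ℤ.*-assoc w u x ⟩
  w * (u * x)  ≈⟨ *-cong (≈-refl {x = w}) ux≈uy ⟩
  w * (u * y)  ≡⟨ ℤ.*-assoc w u y ⟨
  (w * u) * y  ≈⟨ *-cong wu≈1 (≈-refl {x = y}) ⟩
  1ℤ * y       ≡⟨ ℤ.*-identityˡ y ⟩
  y            ∎
  where open ≈-Reasoning N

≈-weaken : ∀ {M N x y} → x ≈[ M * N ] y → x ≈[ N ] y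
≈-weaken {M} {N} {y = y} (q , refl) = q * M , lemma y q M N
  where lemma : ∀ y q M N → y + q * (M * N) ≡ y + q * M * N
        lemma = solve-∀

≡[]⇒≈ : ∀ {n x y} → x ≡[ n ] y → x ≈[ + n ] y
≡[]⇒≈ {n} {x} {y} n∣x-y with Signed.∣ᵤ⇒∣ n∣x-y
... | Signed.divides q eq = −≈0⇒≈ (q , trans eq (sym (ℤ.+-identityˡ (q * + n))))

≈⇒≡[] : ∀ {n x y} → x ≈[ + n ] y → x ≡[ n ] y
≈⇒≡[] {n} x≈y with ≈⇒−≈0 x≈y
... | q , eq = Signed.∣⇒∣ᵤ (Signed.divides q (trans eq (ℤ.+-identityˡ (q * + n))))

-- Residues modulo a prime

private
  quotient-≥ : ∀ {r s d} j → + r ≡ + s + +[1+ j ] * + d → d ℕ.≤ r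
  quotient-≥ {r} {s} {d} j eq = begin
    d                    ≤⟨ ℕ.m≤m+n d (j ℕ.* d) ⟩
    ℕ.suc j ℕ.* d        ≤⟨ ℕ.m≤n+m _ s ⟩
    s ℕ.+ ℕ.suc j ℕ.* d  ≡⟨ ℤ.+-injective r≡ ⟨
    r                    ∎
    where
      open ℕ.≤-Reasoning
      r≡ : + r ≡ + (s ℕ.+ ℕ.suc j ℕ.* d)
      r≡ = trans eq (trans (cong (λ t → + s + t) (sym (ℤ.pos-* (ℕ.suc j) d))) (sym (ℤ.pos-+ s _)))

small-≈-unique : ∀ {d r s} → r ℕ.< d → s ℕ.< d → + r ≈[ + d ] + s → r ≡ s
small-≈-unique {d} {r} {s} _ _ (+ 0 , eq) = ℤ.+-injective (trans eq (lemma (+ s) (+ d)))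
  where lemma : ∀ s d → s + + 0 * d ≡ s
        lemma = solve-∀
small-≈-unique r<d _ (+[1+ j ] , eq) = ⊥-elim (ℕ.<⇒≱ r<d (quotient-≥ j eq))
small-≈-unique {d} {r} {s} _ s<d (-[1+ j ] , eq) = ⊥-elim (ℕ.<⇒≱ s<d (quotient-≥ j (swap (+ r) (+ s) -[1+ j ] (+ d) eq)))
  where swap : ∀ r s q d → r ≡ s + q * d → s ≡ r + - q * d
        swap r s q d refl = lemma s q d
          where lemma : ∀ s q d → s ≡ s + q * d + - q * d
                lemma = solve-∀

module _ (d : ℕ) .{{_ : NonZero d}} where

  residue : ℤ → Fin d
  residue x = fromℕ< (n%ℕd<d x d)

  residue-≈ : ∀ x → + toℕ (residue x) ≈[ + d ] x
  residue-≈ x = ≈-sym (x /ℕ d , trans (a≡a%ℕn+[a/ℕn]*n x d)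
                                      (cong (λ r → + r + x /ℕ d * + d) (sym (Fin.toℕ-fromℕ< _))))

  residue-injective : ∀ {x y} → residue x ≡ residue y → x ≈[ + d ] y
  residue-injective {x} {y} eq =
    ≈-trans (≈-sym (residue-≈ x)) (≈-trans (≈-reflexive (cong (λ r → + toℕ r) eq)) (residue-≈ y))

  ≈⇒residue≡ : ∀ {x y} → x ≈[ + d ] y → residue x ≡ residue y
  ≈⇒residue≡ {x} {y} x≈y = Fin.toℕ-injective
    (small-≈-unique (Fin.toℕ<n (residue x)) (Fin.toℕ<n (residue y))
      (≈-trans (residue-≈ x) (≈-trans x≈y (≈-sym (residue-≈ y)))))

  ≈-dec : ∀ x y → Dec (x ≈[ + d ] y)
  ≈-dec x y = map′ residue-injective ≈⇒residue≡ (residue x Fin.≟ residue y)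

pos-+-*≡* : ∀ {a b c e f} → a ℕ.+ b ℕ.* c ≡ e ℕ.* f → + a + + b * + c ≡ + e * + f
pos-+-*≡* {a} {b} {c} {e} {f} eq = begin
  + a + + b * + c    ≡⟨ cong (λ t → + a + t) (ℤ.pos-* b c) ⟨
  + a + + (b ℕ.* c)  ≡⟨ ℤ.pos-+ a _ ⟨
  + (a ℕ.+ b ℕ.* c)  ≡⟨ cong +_ eq ⟩
  + (e ℕ.* f)        ≡⟨ ℤ.pos-* e f ⟩
  + e * + f          ∎
  where open ≡-Reasoning

module PrimeModulus {p : ℕ} (p-prime : Prime p) where

  instance
    p-nonZero : NonZero p
    p-nonZero = prime⇒nonZero p-prime

  1<p : 1 ℕ.< p
  1<p = ℕ.nonTrivial⇒n>1 p {{prime⇒nonTrivial p-prime}}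

  0≉1 : ¬ 0ℤ ≈[ + p ] 1ℤ
  0≉1 0≈1 = ℕ.0≢1+n (small-≈-unique (ℕ.<-trans ℕ.0<1+n 1<p) 1<p 0≈1)

  -1≉0 : ¬ - 1ℤ ≈[ + p ] 0ℤ
  -1≉0 -1≈0 = 0≉1 (≈-sym (neg-cong -1≈0))

  ∣⇒≈0 : ∀ {x} → p ℕ.∣ ∣ x ∣ → x ≈[ + p ] 0ℤ
  ∣⇒≈0 {x} p∣x with Signed.∣ᵤ⇒∣ {+ p} {x} p∣x
  ... | Signed.divides q eq = q , trans eq (sym (ℤ.+-identityˡ _))

  ≉0⇒coprime : ∀ {y} → ¬ y ≈[ + p ] 0ℤ → Coprime p ∣ y ∣
  ≉0⇒coprime y≉0 (d∣p , d∣y) with prime⇒irreducible p-prime d∣p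
  ... | inj₁ d≡1 = d≡1
  ... | inj₂ refl = ⊥-elim (y≉0 (∣⇒≈0 d∣y))

  coprime⇒invertible : ∀ {n} → Coprime p n → Σ ℤ λ w → w * + n ≈[ + p ] 1ℤ
  coprime⇒invertible {n} c with coprime-Bézout c
  ... | Bézout.+- x y eq = - + y , (- + x , negate {+ x} {+ y} {+ n} {+ p} (pos-+-*≡* {1} {y} {n} {x} {p} eq))
    where
      negate : ∀ {x y n p} → 1ℤ + y * n ≡ x * p → - y * n ≡ 1ℤ + - x * p
      negate {x} {y} {n} {p} eq = begin
        - y * n            ≡⟨ l₁ y n ⟩
        1ℤ - (1ℤ + y * n)  ≡⟨ cong (λ t → 1ℤ - t) eq ⟩
        1ℤ - x * p         ≡⟨ l₂ x p ⟩
        1ℤ + - x * p       ∎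
        where
          open ≡-Reasoning
          l₁ : ∀ y n → - y * n ≡ 1ℤ - (1ℤ + y * n)
          l₁ = solve-∀
          l₂ : ∀ x p → 1ℤ - x * p ≡ 1ℤ + - x * p
          l₂ = solve-∀
  ... | Bézout.-+ x y eq = + y , (+ x , sym (pos-+-*≡* {1} {x} {p} {y} {n} eq))

  -- Only the existence of inverses matters; keeping the witnesses abstract stops the
  -- type checker from unfolding the Bézout computation behind them.
  abstract
    ≉0⇒invertible : ∀ {y} → ¬ y ≈[ + p ] 0ℤ → Σ ℤ λ w → w * y ≈[ + p ] 1ℤ
    ≉0⇒invertible {+ n} y≉0 = coprime⇒invertible (≉0⇒coprime y≉0)
    ≉0⇒invertible { -[1+ n ]} y≉0 with coprime⇒invertible (≉0⇒coprime y≉0)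
    ... | w , w∣y∣≈1 = - w , ≈-trans (≈-reflexive (lemma w (+ ℕ.suc n))) w∣y∣≈1
      where lemma : ∀ w m → - w * - m ≡ w * m
            lemma = solve-∀

  *-cancelˡ-≈ : ∀ {u x y} → ¬ u ≈[ + p ] 0ℤ → u * x ≈[ + p ] u * y → x ≈[ + p ] y
  *-cancelˡ-≈ {u} u≉0 with ≉0⇒invertible u≉0
  ... | w , wu≈1 = invertible-cancelˡ {w = w} {u} wu≈1

  -- One Newton step w ↦ w (2 - w u) lifts an inverse modulo p to one modulo p².
  ≉0⇒invertible-mod-p² : ∀ {u} → ¬ u ≈[ + p ] 0ℤ → Σ ℤ λ w → w * u ≈[ + p * + p ] 1ℤ
  ≉0⇒invertible-mod-p² {u} u≉0 with ≉0⇒invertible u≉0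
  ... | w , (k , wu≡1+kp) = w * (+ 2 - w * u) , (- (k * k) , (begin
    w * (+ 2 - w * u) * u        ≡⟨ l₁ w u ⟩
    (w * u) * (+ 2 - w * u)      ≡⟨ cong (λ z → z * (+ 2 - z)) wu≡1+kp ⟩
    (1ℤ + k * + p) * (+ 2 - (1ℤ + k * + p))  ≡⟨ l₂ k (+ p) ⟩
    1ℤ + - (k * k) * (+ p * + p) ∎))
    where
      open ≡-Reasoning
      l₁ : ∀ w u → w * (+ 2 - w * u) * u ≡ (w * u) * (+ 2 - w * u)
      l₁ = solve-∀
      l₂ : ∀ k P → (1ℤ + k * P) * (+ 2 - (1ℤ + k * P)) ≡ 1ℤ + - (k * k) * (P * P)
      l₂ = solve-∀

-- Integer 2 × 2 matrices

infix 4 _≈ₘ[_]_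

mat-cong : ∀ {a a′ b b′ c c′ d d′} → a ≡ a′ → b ≡ b′ → c ≡ c′ → d ≡ d′ →
           mat a b c d ≡ mat a′ b′ c′ d′
mat-cong refl refl refl refl = refl

scalar : ℤ → Mat
scalar k = mat k 0ℤ 0ℤ k

·-assoc : ∀ g h k → (g · h) · k ≡ g · (h · k)
·-assoc (mat a b c d) (mat e f g h) (mat i j k l) =
  mat-cong (entry a b e f g h i j k l) (entry a b e f g h j i l k)
           (entry c d e f g h i j k l) (entry c d e f g h j i l k)
  where entry : ∀ a b e f g h i j k l → (a * e + b * g) * i + (a * f + b * h) * k ≡ a * (e * i + f * k) + b * (g * i + h * k)
        entry = solve-∀

·-identityˡ : ∀ g → I₂ · g ≡ g
·-identityˡ (mat a b c d) = mat-cong (top a c) (top b d) (bottom a c) (bottom b d)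
  where top : ∀ a c → 1ℤ * a + 0ℤ * c ≡ a
        top = solve-∀
        bottom : ∀ a c → 0ℤ * a + 1ℤ * c ≡ c
        bottom = solve-∀

·-identityʳ : ∀ g → g · I₂ ≡ g
·-identityʳ (mat a b c d) = mat-cong (left a b) (right a b) (left c d) (right c d)
  where left : ∀ a b → a * 1ℤ + b * 0ℤ ≡ a
        left = solve-∀
        right : ∀ a b → a * 0ℤ + b * 1ℤ ≡ b
        right = solve-∀

adj-· : ∀ g h → adj (g · h) ≡ adj h · adj g
adj-· (mat a b c d) (mat e f g h) = mat-cong (l₁ c d f h) (l₂ a b f h) (l₃ c d e g) (l₄ a b e g)
  where l₁ : ∀ c d f h → c * f + d * h ≡ h * d + - f * - c
        l₁ = solve-∀
        l₂ : ∀ a b f h → - (a * f + b * h) ≡ h * - b + - f * a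
        l₂ = solve-∀
        l₃ : ∀ c d e g → - (c * e + d * g) ≡ - g * d + e * - c
        l₃ = solve-∀
        l₄ : ∀ a b e g → a * e + b * g ≡ - g * - b + e * a
        l₄ = solve-∀

adj-involutive : ∀ g → adj (adj g) ≡ g
adj-involutive (mat a b c d) = mat-cong refl (ℤ.neg-involutive b) (ℤ.neg-involutive c) refl

det-· : ∀ g h → det (g · h) ≡ det g * det h
det-· (mat a b c d) (mat e f g h) = lemma a b c d e f g h
  where lemma : ∀ a b c d e f g h → (a * e + b * g) * (c * f + d * h) - (a * f + b * h) * (c * e + d * g) ≡ (a * d - b * c) * (e * h - f * g)
        lemma = solve-∀

det-adj : ∀ g → det (adj g) ≡ det g
det-adj (mat a b c d) = lemma a b c d
  where lemma : ∀ a b c d → d * a - - b * - c ≡ a * d - b * c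
        lemma = solve-∀

adj-·-self : ∀ g → adj g · g ≡ scalar (det g)
adj-·-self (mat a b c d) = mat-cong (l₁ a b c d) (l₂ b d) (l₃ a c) (l₄ a b c d)
  where l₁ : ∀ a b c d → d * a + - b * c ≡ a * d - b * c
        l₁ = solve-∀
        l₂ : ∀ b d → d * b + - b * d ≡ 0ℤ
        l₂ = solve-∀
        l₃ : ∀ a c → - c * a + a * c ≡ 0ℤ
        l₃ = solve-∀
        l₄ : ∀ a b c d → - c * b + a * d ≡ a * d - b * c
        l₄ = solve-∀

·-adj-self : ∀ g → g · adj g ≡ scalar (det g)
·-adj-self g = begin
  g · adj g               ≡⟨ cong (_· adj g) (adj-involutive g) ⟨
  adj (adj g) · adj g     ≡⟨ adj-·-self (adj g) ⟩
  scalar (det (adj g))    ≡⟨ cong scalar (det-adj g) ⟩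
  scalar (det g)          ∎
  where open ≡-Reasoning

record _≈ₘ[_]_ (g : Mat) (N : ℤ) (h : Mat) : Set where
  constructor entrywise
  field
    a≈ : a g ≈[ N ] a h
    b≈ : b g ≈[ N ] b h
    c≈ : c g ≈[ N ] c h
    d≈ : d g ≈[ N ] d h
open _≈ₘ[_]_ public

≡ₘ[]⇒≈ₘ : ∀ {n g h} → g ≡ₘ[ n ] h → g ≈ₘ[ + n ] h
≡ₘ[]⇒≈ₘ (a≡ , b≡ , c≡ , d≡) = entrywise (≡[]⇒≈ a≡) (≡[]⇒≈ b≡) (≡[]⇒≈ c≡) (≡[]⇒≈ d≡)

≈ₘ⇒≡ₘ[] : ∀ {n g h} → g ≈ₘ[ + n ] h → g ≡ₘ[ n ] h
≈ₘ⇒≡ₘ[] (entrywise a≈ b≈ c≈ d≈) = ≈⇒≡[] a≈ , ≈⇒≡[] b≈ , ≈⇒≡[] c≈ , ≈⇒≡[] d≈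

module _ {N : ℤ} where

  ≈ₘ-reflexive : ∀ {g h} → g ≡ h → g ≈ₘ[ N ] h
  ≈ₘ-reflexive refl = entrywise ≈-refl ≈-refl ≈-refl ≈-refl

  ≈ₘ-refl : ∀ {g} → g ≈ₘ[ N ] g
  ≈ₘ-refl = ≈ₘ-reflexive refl

  ≈ₘ-sym : ∀ {g h} → g ≈ₘ[ N ] h → h ≈ₘ[ N ] g
  ≈ₘ-sym (entrywise a≈ b≈ c≈ d≈) = entrywise (≈-sym a≈) (≈-sym b≈) (≈-sym c≈) (≈-sym d≈)

  ≈ₘ-trans : ∀ {g h k} → g ≈ₘ[ N ] h → h ≈ₘ[ N ] k → g ≈ₘ[ N ] k
  ≈ₘ-trans (entrywise a≈ b≈ c≈ d≈) (entrywise a≈′ b≈′ c≈′ d≈′) =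
    entrywise (≈-trans a≈ a≈′) (≈-trans b≈ b≈′) (≈-trans c≈ c≈′) (≈-trans d≈ d≈′)

≈ₘ-setoid : ℤ → Setoid 0ℓ 0ℓ
≈ₘ-setoid N = record
  { Carrier = Mat
  ; _≈_ = _≈ₘ[ N ]_
  ; isEquivalence = record { refl = ≈ₘ-refl ; sym = ≈ₘ-sym ; trans = ≈ₘ-trans }
  }

module ≈ₘ-Reasoning (N : ℤ) = SetoidReasoning (≈ₘ-setoid N)

module _ {N : ℤ} where

  ·-cong : ∀ {g g′ h h′} → g ≈ₘ[ N ] g′ → h ≈ₘ[ N ] h′ → g · h ≈ₘ[ N ] g′ · h′
  ·-cong {mat _ _ _ _} {mat _ _ _ _} {mat _ _ _ _} {mat _ _ _ _}
         (entrywise a≈ b≈ c≈ d≈) (entrywise a≈′ b≈′ c≈′ d≈′) =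
    entrywise (+-cong (*-cong a≈ a≈′) (*-cong b≈ c≈′)) (+-cong (*-cong a≈ b≈′) (*-cong b≈ d≈′))
              (+-cong (*-cong c≈ a≈′) (*-cong d≈ c≈′)) (+-cong (*-cong c≈ b≈′) (*-cong d≈ d≈′))

  adj-cong : ∀ {g g′} → g ≈ₘ[ N ] g′ → adj g ≈ₘ[ N ] adj g′
  adj-cong {mat _ _ _ _} {mat _ _ _ _} (entrywise a≈ b≈ c≈ d≈) =
    entrywise d≈ (neg-cong b≈) (neg-cong c≈) a≈

  adj-inverseˡ : ∀ g → det g ≈[ N ] 1ℤ → adj g · g ≈ₘ[ N ] I₂
  adj-inverseˡ g det≈1 rewrite adj-·-self g = entrywise det≈1 ≈-refl ≈-refl det≈1

  ·-cancelˡ : ∀ w {g h} → det w ≈[ N ] 1ℤ → w · g ≈ₘ[ N ] w · h → g ≈ₘ[ N ] h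
  ·-cancelˡ w {g} {h} det≈1 wg≈wh = begin
    g                ≡⟨ ·-identityˡ g ⟨
    I₂ · g           ≈⟨ ·-cong (adj-inverseˡ w det≈1) ≈ₘ-refl ⟨
    (adj w · w) · g  ≡⟨ ·-assoc (adj w) w g ⟩
    adj w · (w · g)  ≈⟨ ·-cong (≈ₘ-refl {g = adj w}) wg≈wh ⟩
    adj w · (w · h)  ≡⟨ ·-assoc (adj w) w h ⟨
    (adj w · w) · h  ≈⟨ ·-cong (adj-inverseˡ w det≈1) ≈ₘ-refl ⟩
    I₂ · h           ≡⟨ ·-identityˡ h ⟩
    h                ∎
    where open ≈ₘ-Reasoning N

-- Counting

open Injection using (to; injective)

inject≤-↣ : ∀ {m n} → m ≤ n → Fin m ↣ Fin n
inject≤-↣ m≤n = mk↣ (Fin.inject≤-injective m≤n m≤n _ _)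

suc-↣ : ∀ {m n} → Fin m ↣ Fin n → Fin m ↣ Fin (suc n)
suc-↣ e = mk↣ {to = suc ∘ to e} (injective e ∘ Fin.suc-injective)

zero∷-↣ : ∀ {m n} → Fin m ↣ Fin n → Fin (suc m) ↣ Fin (suc n)
zero∷-↣ {m} {n} e = mk↣ {to = f} f-injective
  where
    f : Fin (suc m) → Fin (suc n)
    f zero = zero
    f (suc i) = suc (to e i)
    f-injective : ∀ {i j} → f i ≡ f j → i ≡ j
    f-injective {zero} {zero} _ = refl
    f-injective {suc i} {suc j} eq = cong suc (injective e (Fin.suc-injective eq))

record Split {n : ℕ} (P : Pred (Fin n) 0ℓ) : Set where
  field
    #sat #unsat   : ℕ
    sat           : Fin #sat ↣ Fin n
    unsat         : Fin #unsat ↣ Fin n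
    sat⇒P         : ∀ i → P (to sat i)
    unsat⇒¬P      : ∀ i → ¬ P (to unsat i)
    #sat+#unsat   : #sat ℕ.+ #unsat ≡ n

split : ∀ {n} {P : Pred (Fin n) 0ℓ} → Decidable P → Split P
split {ℕ.zero} _ = record
  { #sat = 0 ; #unsat = 0 ; sat = mk↣ {to = λ ()} (λ {}) ; unsat = mk↣ {to = λ ()} (λ {})
  ; sat⇒P = λ () ; unsat⇒¬P = λ () ; #sat+#unsat = refl }
split {suc n} {P} P? with split (P? ∘ suc) | P? zero
... | s | yes P0 = record
  { #sat = suc #sat ; #unsat = #unsat ; sat = zero∷-↣ sat ; unsat = suc-↣ unsat
  ; sat⇒P = λ { zero → P0 ; (suc i) → sat⇒P i } ; unsat⇒¬P = unsat⇒¬P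
  ; #sat+#unsat = cong suc #sat+#unsat }
  where open Split s
... | s | no ¬P0 = record
  { #sat = #sat ; #unsat = suc #unsat ; sat = suc-↣ sat ; unsat = zero∷-↣ unsat
  ; sat⇒P = sat⇒P ; unsat⇒¬P = λ { zero → ¬P0 ; (suc i) → unsat⇒¬P i }
  ; #sat+#unsat = trans (ℕ.+-suc #sat #unsat) (cong suc #sat+#unsat) }
  where open Split s

-- Split off the fibre over zero; if it is small, recurse into the other fibres via punchOut.
fibre-pigeonhole : ∀ k q {n} → k ℕ.* q < n → (g : Fin n → Fin k) →
                   ∃ λ v → Σ (Fin (suc q) ↣ Fin n) λ e → ∀ i → g (to e i) ≡ v
fibre-pigeonhole ℕ.zero q {suc n} _ g with () ← g zero
fibre-pigeonhole (suc k) q {n} kq<n g with split (λ i → g i Fin.≟ zero)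
... | s with q ℕ.<? Split.#sat s
...   | yes q<#sat = zero , (sat ↣-∘ inject≤-↣ q<#sat) , λ i → sat⇒P _
  where open Split s
...   | no q≮#sat = shift (fibre-pigeonhole k q k*q<#unsat g′)
  where
    open Split s
    g′ : Fin #unsat → Fin k
    g′ i = punchOut (≢-sym (unsat⇒¬P i))
    k*q<#unsat : k ℕ.* q < #unsat
    k*q<#unsat = ℕ.+-cancelˡ-< q (k ℕ.* q) #unsat (begin-strict
      q ℕ.+ k ℕ.* q    <⟨ kq<n ⟩
      n                ≡⟨ #sat+#unsat ⟨
      #sat ℕ.+ #unsat  ≤⟨ ℕ.+-monoˡ-≤ #unsat (ℕ.≮⇒≥ q≮#sat) ⟩
      q ℕ.+ #unsat     ∎)
      where open ℕ.≤-Reasoning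
    shift : (∃ λ v → Σ (Fin (suc q) ↣ Fin #unsat) λ e → ∀ i → g′ (to e i) ≡ v) →
            ∃ λ v → Σ (Fin (suc q) ↣ Fin n) λ e → ∀ i → g (to e i) ≡ v
    shift (v , e , g′e≡v) = suc v , (unsat ↣-∘ e) , λ i →
      trans (sym (Fin.punchIn-punchOut (≢-sym (unsat⇒¬P (to e i))))) (cong suc (g′e≡v i))

homogeneous-half : ∀ n {P Q : Pred (Fin n) 0ℓ} → (∀ i → P i ⊎ Q i) →
                   Σ (Fin (n / 2) ↣ Fin n) λ e → (∀ i → P (to e i)) ⊎ (∀ i → Q (to e i))
homogeneous-half n {P} {Q} P⊎Q with n / 2 | m/n*n≤m n 2
... | ℕ.zero | _ = mk↣ {to = λ ()} (λ {}) , inj₁ (λ ())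
... | suc q | [q+1]*2≤n = homogeneous (fibre-pigeonhole 2 q 2q<n colour)
  where
    colour : Fin n → Fin 2
    colour i with P⊎Q i
    ... | inj₁ _ = zero
    ... | inj₂ _ = suc zero
    colour≡0⇒P : ∀ i → colour i ≡ zero → P i
    colour≡0⇒P i eq with P⊎Q i | eq
    ... | inj₁ Pi | _ = Pi
    ... | inj₂ _ | ()
    colour≡1⇒Q : ∀ i → colour i ≡ suc zero → Q i
    colour≡1⇒Q i eq with P⊎Q i | eq
    ... | inj₁ _ | ()
    ... | inj₂ Qi | _ = Qi
    2q<n : 2 ℕ.* q < n
    2q<n = ℕ.<-≤-trans (ℕ.s≤s (ℕ.≤-trans (ℕ.≤-reflexive (ℕ.*-comm 2 q)) (ℕ.n≤1+n _))) [q+1]*2≤n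
    homogeneous : (∃ λ v → Σ (Fin (suc q) ↣ Fin n) λ e → ∀ i → colour (to e i) ≡ v) →
                  Σ (Fin (suc q) ↣ Fin n) λ e → (∀ i → P (to e i)) ⊎ (∀ i → Q (to e i))
    homogeneous (zero , e , c) = e , inj₁ (λ i → colour≡0⇒P _ (c i))
    homogeneous (suc zero , e , c) = e , inj₂ (λ i → colour≡1⇒Q _ (c i))

-- Matrices modulo a prime

module _ (m : ℕ) .{{_ : NonZero m}} where

  ≈ₘ-dec : ∀ g h → Dec (g ≈ₘ[ + m ] h)
  ≈ₘ-dec g h = map′ (λ (a≈ , b≈ , c≈ , d≈) → entrywise a≈ b≈ c≈ d≈)
                    (λ g≈h → a≈ g≈h , b≈ g≈h , c≈ g≈h , d≈ g≈h)
                    (≈-dec m (a g) (a h) ×-dec ≈-dec m (b g) (b h) ×-dec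
                     ≈-dec m (c g) (c h) ×-dec ≈-dec m (d g) (d h))

module _ {N : ℤ} where

  ⋆-cong : ∀ {k k′ A A′} → k ≈[ N ] k′ → A ≈ₘ[ N ] A′ → k ⋆ A ≈ₘ[ N ] k′ ⋆ A′
  ⋆-cong {A = mat _ _ _ _} {mat _ _ _ _} k≈k′ (entrywise a≈ b≈ c≈ d≈) =
    entrywise (*-cong k≈k′ a≈) (*-cong k≈k′ b≈) (*-cong k≈k′ c≈) (*-cong k≈k′ d≈)

  ⊕≈0⇒≈ : ∀ {x y A B} → (x ⋆ A) ⊕ (y ⋆ B) ≈ₘ[ N ] zeroM → y ⋆ B ≈ₘ[ N ] (- x) ⋆ A
  ⊕≈0⇒≈ {x} {y} {mat _ _ _ _} {mat _ _ _ _} (entrywise a≈ b≈ c≈ d≈) =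
    entrywise (solve-for a≈) (solve-for b≈) (solve-for c≈) (solve-for d≈)
    where
      solve-for : ∀ {u v} → x * u + y * v ≈[ N ] 0ℤ → y * v ≈[ N ] - x * u
      solve-for {u} {v} sum≈0 = begin
        y * v                        ≡⟨ l₁ x y u v ⟩
        (x * u + y * v) - x * u      ≈⟨ −-cong sum≈0 ≈-refl ⟩
        0ℤ - x * u                   ≡⟨ l₂ x u ⟩
        - x * u                      ∎
        where
          open ≈-Reasoning N
          l₁ : ∀ x y u v → y * v ≡ (x * u + y * v) - x * u
          l₁ = solve-∀
          l₂ : ∀ x u → 0ℤ - x * u ≡ - x * u
          l₂ = solve-∀

⋆-⋆ : ∀ k l A → k ⋆ (l ⋆ A) ≡ (k * l) ⋆ A
⋆-⋆ k l (mat a b c d) =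
  mat-cong (sym (ℤ.*-assoc k l a)) (sym (ℤ.*-assoc k l b)) (sym (ℤ.*-assoc k l c)) (sym (ℤ.*-assoc k l d))

⋆-identityˡ : ∀ A → 1ℤ ⋆ A ≡ A
⋆-identityˡ (mat a b c d) = mat-cong (ℤ.*-identityˡ a) (ℤ.*-identityˡ b) (ℤ.*-identityˡ c) (ℤ.*-identityˡ d)

⋆-zeroʳ : ∀ k → k ⋆ zeroM ≡ zeroM
⋆-zeroʳ k = mat-cong (ℤ.*-zeroʳ k) (ℤ.*-zeroʳ k) (ℤ.*-zeroʳ k) (ℤ.*-zeroʳ k)

LinearlyIndependent : ℕ → Mat → Mat → Set
LinearlyIndependent p A B = ∀ (x y : ℤ) → ((x ⋆ A) ⊕ (y ⋆ B)) ≡ₘ[ p ] zeroM →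
                            (x ≡[ p ] 0ℤ) × (y ≡[ p ] 0ℤ)

module _ {p : ℕ} (p-prime : Prime p) where
  open PrimeModulus p-prime

  private
    triple : Fin p → Fin p → Fin p → Fin (p ℕ.* (p ℕ.* p))
    triple x y z = combine x (combine y z)

    triple-injective : ∀ {x y z x′ y′ z′} → triple x y z ≡ triple x′ y′ z′ →
                       x ≡ x′ × y ≡ y′ × z ≡ z′
    triple-injective {x} {y} {z} {x′} {y′} {z′} eq
      with refl , eq′ ← Fin.combine-injective x (combine y z) x′ (combine y′ z′) eq
      with refl , refl ← Fin.combine-injective y z y′ z′ eq′ = refl , refl , refl

  -- When a ≡ 0 the relation bc ≡ -1 makes c invertible, so (a, c, d) determine b;
  -- otherwise a is invertible and (a, b, c) determine d = (1 + bc)/a.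
  encode : Mat → Fin (p ℕ.* (p ℕ.* p))
  encode (mat a b c d) with ≈-dec p a 0ℤ
  ... | yes _ = triple (residue p a) (residue p c) (residue p d)
  ... | no _  = triple (residue p a) (residue p b) (residue p c)

  private
    det≈1⇒ad≈1+bc : ∀ a b c d → a * d - b * c ≈[ + p ] 1ℤ → a * d ≈[ + p ] 1ℤ + b * c
    det≈1⇒ad≈1+bc a b c d det≈1 = begin
      a * d                ≡⟨ lemma a b c d ⟩
      (a * d - b * c) + b * c ≈⟨ +-cong det≈1 ≈-refl ⟩
      1ℤ + b * c           ∎
      where
        open ≈-Reasoning (+ p)
        lemma : ∀ a b c d → a * d ≡ (a * d - b * c) + b * c
        lemma = solve-∀

    det≈1⇒bc≈-1 : ∀ a b c d → a * d - b * c ≈[ + p ] 1ℤ → a ≈[ + p ] 0ℤ → b * c ≈[ + p ] - 1ℤ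
    det≈1⇒bc≈-1 a b c d det≈1 a≈0 = begin
      b * c                   ≡⟨ lemma b c ⟩
      - (0ℤ * d - b * c)      ≈⟨ neg-cong (−-cong (*-cong a≈0 ≈-refl) ≈-refl) ⟨
      - (a * d - b * c)       ≈⟨ neg-cong det≈1 ⟩
      - 1ℤ                    ∎
      where
        open ≈-Reasoning (+ p)
        lemma : ∀ b c → b * c ≡ - (0ℤ * d - b * c)
        lemma b c = sym (trans (cong -_ (ℤ.+-identityˡ (- (b * c)))) (ℤ.neg-involutive (b * c)))

    *-comm≈ : ∀ x y → x * y ≈[ + p ] y * x
    *-comm≈ x y = ≈-reflexive (ℤ.*-comm x y)

  encode-injective : ∀ g h → det g ≈[ + p ] 1ℤ → det h ≈[ + p ] 1ℤ →
                     encode g ≡ encode h → g ≈ₘ[ + p ] h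
  encode-injective (mat a b c d) (mat a′ b′ c′ d′) det≈1 det′≈1 eq
    with ≈-dec p a 0ℤ | ≈-dec p a′ 0ℤ
  ... | yes a≈0 | yes a′≈0 = yes-yes (triple-injective eq)
    where
      yes-yes : residue p a ≡ residue p a′ × residue p c ≡ residue p c′ × residue p d ≡ residue p d′ →
                mat a b c d ≈ₘ[ + p ] mat a′ b′ c′ d′
      yes-yes (a≡ , c≡ , d≡) = entrywise (residue-injective p a≡) b≈b′ c≈c′ (residue-injective p d≡)
        where
          c≈c′ : c ≈[ + p ] c′
          c≈c′ = residue-injective p c≡
          bc≈-1 : b * c ≈[ + p ] - 1ℤ
          bc≈-1 = det≈1⇒bc≈-1 a b c d det≈1 a≈0
          c≉0 : ¬ c ≈[ + p ] 0ℤ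
          c≉0 c≈0 = -1≉0 (≈-trans (≈-sym bc≈-1) (≈-trans (*-cong (≈-refl {x = b}) c≈0) (≈-reflexive (ℤ.*-zeroʳ b))))
          b≈b′ : b ≈[ + p ] b′
          b≈b′ = *-cancelˡ-≈ c≉0 (begin
            c * b    ≈⟨ *-comm≈ c b ⟩
            b * c    ≈⟨ bc≈-1 ⟩
            - 1ℤ     ≈⟨ det≈1⇒bc≈-1 a′ b′ c′ d′ det′≈1 a′≈0 ⟨
            b′ * c′  ≈⟨ *-cong (≈-refl {x = b′}) c≈c′ ⟨
            b′ * c   ≈⟨ *-comm≈ b′ c ⟩
            c * b′   ∎)
            where open ≈-Reasoning (+ p)
  ... | yes a≈0 | no a′≉0 = ⊥-elim (a′≉0 (≈-trans (≈-sym (residue-injective p (proj₁ (triple-injective eq)))) a≈0))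
  ... | no a≉0 | yes a′≈0 = ⊥-elim (a≉0 (≈-trans (residue-injective p (proj₁ (triple-injective eq))) a′≈0))
  ... | no a≉0 | no a′≉0 = no-no (triple-injective eq)
    where
      no-no : residue p a ≡ residue p a′ × residue p b ≡ residue p b′ × residue p c ≡ residue p c′ →
              mat a b c d ≈ₘ[ + p ] mat a′ b′ c′ d′
      no-no (a≡ , b≡ , c≡) = entrywise a≈a′ b≈b′ c≈c′ d≈d′
        where
          a≈a′ : a ≈[ + p ] a′
          a≈a′ = residue-injective p a≡
          b≈b′ : b ≈[ + p ] b′
          b≈b′ = residue-injective p b≡
          c≈c′ : c ≈[ + p ] c′
          c≈c′ = residue-injective p c≡
          d≈d′ : d ≈[ + p ] d′
          d≈d′ = *-cancelˡ-≈ a≉0 (begin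
            a * d        ≈⟨ det≈1⇒ad≈1+bc a b c d det≈1 ⟩
            1ℤ + b * c   ≈⟨ +-cong (≈-refl {x = 1ℤ}) (*-cong b≈b′ c≈c′) ⟩
            1ℤ + b′ * c′ ≈⟨ det≈1⇒ad≈1+bc a′ b′ c′ d′ det′≈1 ⟨
            a′ * d′      ≈⟨ *-cong a≈a′ (≈-refl {x = d′}) ⟨
            a * d′       ∎)
            where open ≈-Reasoning (+ p)

  ⋆-cancel : ∀ w y A → w * y ≈[ + p ] 1ℤ → A ≈ₘ[ + p ] w ⋆ (y ⋆ A)
  ⋆-cancel w y A wy≈1 = begin
    A              ≡⟨ ⋆-identityˡ A ⟨
    1ℤ ⋆ A         ≈⟨ ⋆-cong wy≈1 (≈ₘ-refl {g = A}) ⟨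
    (w * y) ⋆ A    ≡⟨ ⋆-⋆ w y A ⟨
    w ⋆ (y ⋆ A)    ∎
    where open ≈ₘ-Reasoning (+ p)

  ⋆≈0⇒≈0 : ∀ {k A} → ¬ A ≈ₘ[ + p ] zeroM → k ⋆ A ≈ₘ[ + p ] zeroM → k ≈[ + p ] 0ℤ
  ⋆≈0⇒≈0 {k} {A} A≉0 kA≈0 with ≈-dec p k 0ℤ
  ... | yes k≈0 = k≈0
  ... | no k≉0 with ≉0⇒invertible k≉0
  ...   | w , wk≈1 = ⊥-elim (A≉0 (begin
    A              ≈⟨ ⋆-cancel w k A wk≈1 ⟩
    w ⋆ (k ⋆ A)    ≈⟨ ⋆-cong (≈-refl {x = w}) kA≈0 ⟩
    w ⋆ zeroM      ≡⟨ ⋆-zeroʳ w ⟩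
    zeroM          ∎))
    where open ≈ₘ-Reasoning (+ p)

  independent-of-span : ∀ {A B} → ¬ A ≈ₘ[ + p ] zeroM →
                        (∀ (l : Fin p) → ¬ B ≈ₘ[ + p ] (+ toℕ l) ⋆ A) → LinearlyIndependent p A B
  independent-of-span {A} {B} A≉0 B∉span x y comb≡0 = by-cases (≈-dec p y 0ℤ)
    where
      yB≈-xA : y ⋆ B ≈ₘ[ + p ] (- x) ⋆ A
      yB≈-xA = ⊕≈0⇒≈ {x = x} {y} {A} {B} (≡ₘ[]⇒≈ₘ comb≡0)
      -xA≈0 : y ≈[ + p ] 0ℤ → (- x) ⋆ A ≈ₘ[ + p ] zeroM
      -xA≈0 y≈0 = ≈ₘ-trans (≈ₘ-sym yB≈-xA) (⋆-cong y≈0 (≈ₘ-refl {g = B}))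
      B∈span : ∀ {w} → w * y ≈[ + p ] 1ℤ → B ≈ₘ[ + p ] (+ toℕ (residue p (w * - x))) ⋆ A
      B∈span {w} wy≈1 = begin
        B                                 ≈⟨ ⋆-cancel w y B wy≈1 ⟩
        w ⋆ (y ⋆ B)                       ≈⟨ ⋆-cong (≈-refl {x = w}) yB≈-xA ⟩
        w ⋆ ((- x) ⋆ A)                   ≡⟨ ⋆-⋆ w (- x) A ⟩
        (w * - x) ⋆ A                     ≈⟨ ⋆-cong (residue-≈ p (w * - x)) (≈ₘ-refl {g = A}) ⟨
        (+ toℕ (residue p (w * - x))) ⋆ A ∎
        where open ≈ₘ-Reasoning (+ p)
      by-cases : Dec (y ≈[ + p ] 0ℤ) → (x ≡[ p ] 0ℤ) × (y ≡[ p ] 0ℤ)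
      by-cases (yes y≈0) = ≈⇒≡[] {p} {x} {0ℤ} x≈0 , ≈⇒≡[] {p} {y} {0ℤ} y≈0
        where x≈0 : x ≈[ + p ] 0ℤ
              x≈0 = ≈-trans (≈-reflexive (sym (ℤ.neg-involutive x))) (neg-cong (⋆≈0⇒≈0 A≉0 (-xA≈0 y≈0)))
      by-cases (no y≉0) = ⊥-elim (B∉span (residue p (w * - x)) (B∈span {w} wy≈1))
        where w : ℤ
              w = proj₁ (≉0⇒invertible y≉0)
              wy≈1 : w * y ≈[ + p ] 1ℤ
              wy≈1 = proj₂ (≉0⇒invertible y≉0)

  two-independent : (C : Fin (ℕ.suc p) → Mat) → (∀ r s → C r ≈ₘ[ + p ] C s → r ≡ s) →
                    ∃₂ λ r s → LinearlyIndependent p (C r) (C s)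
  two-independent C C-injective = r , s , independent-of-span Cr≉0 (λ l Cs≈lCr → s∉span (l , Cs≈lCr))
    where
      1<1+p : 1 ℕ.< ℕ.suc p
      1<1+p = ℕ.<-trans 1<p (ℕ.n<1+n p)
      nonzero : ∃ λ r → ¬ C r ≈ₘ[ + p ] zeroM
      nonzero with ≈ₘ-dec p (C zero) zeroM
      ... | no C₀≉0 = zero , C₀≉0
      ... | yes C₀≈0 = fromℕ< 1<1+p , λ C₁≈0 →
        ℕ.0≢1+n (trans (cong toℕ (C-injective _ _ (≈ₘ-trans C₀≈0 (≈ₘ-sym C₁≈0)))) (Fin.toℕ-fromℕ< 1<1+p))
      r : Fin (ℕ.suc p)
      r = proj₁ nonzero
      Cr≉0 : ¬ C r ≈ₘ[ + p ] zeroM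
      Cr≉0 = proj₂ nonzero
      InSpan : Fin (ℕ.suc p) → Set
      InSpan s = ∃ λ (l : Fin p) → C s ≈ₘ[ + p ] (+ toℕ l) ⋆ C r
      InSpan? : ∀ s → Dec (InSpan s)
      InSpan? s = Fin.any? (λ l → ≈ₘ-dec p (C s) ((+ toℕ l) ⋆ C r))
      not-all-in-span : ¬ (∀ s → InSpan s)
      not-all-in-span all with Fin.pigeonhole (ℕ.n<1+n p) (λ s → proj₁ (all s))
      ... | i , j , i<j , lᵢ≡lⱼ = Fin.<⇒≢ i<j (C-injective i j (begin
        C i                           ≈⟨ proj₂ (all i) ⟩
        (+ toℕ (proj₁ (all i))) ⋆ C r ≡⟨ cong (λ l → (+ toℕ l) ⋆ C r) lᵢ≡lⱼ ⟩
        (+ toℕ (proj₁ (all j))) ⋆ C r ≈⟨ proj₂ (all j) ⟨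
        C j                           ∎))
        where open ≈ₘ-Reasoning (+ p)
      outside-span : ∃ λ s → ¬ InSpan s
      outside-span = Fin.¬∀⟶∃¬ (ℕ.suc p) InSpan InSpan? not-all-in-span
      s : Fin (ℕ.suc p)
      s = proj₁ outside-span
      s∉span : ¬ InSpan s
      s∉span = proj₂ outside-span

-- The groups G₂ and V₁

lift-≈I : ∀ {N g} → g ≈ₘ[ N ] I₂ → ∃ λ A → g ≡ I₂ ⊕ (N ⋆ A)
lift-≈I {N} {mat _ _ _ _} (entrywise (qa , refl) (qb , refl) (qc , refl) (qd , refl)) =
  mat qa qb qc qd , mat-cong (comm 1ℤ qa) (comm 0ℤ qb) (comm 0ℤ qc) (comm 1ℤ qd)
  where comm : ∀ u q → u + q * N ≡ u + N * q
        comm u q = cong (λ t → u + t) (ℤ.*-comm q N)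

det-I⊕⋆ : ∀ N A → det (I₂ ⊕ (N ⋆ A)) - 1ℤ ≡ N * (tr A + N * det A)
det-I⊕⋆ N (mat a b c d) = lemma N a b c d
  where lemma : ∀ N a b c d → (1ℤ + N * a) * (1ℤ + N * d) - (0ℤ + N * b) * (0ℤ + N * c) - 1ℤ ≡ N * (a + d + N * (a * d - b * c))
        lemma = solve-∀

det-I⊕⋆≡1⇒tr≈0 : ∀ {N} A → N ≢ 0ℤ → det (I₂ ⊕ (N ⋆ A)) ≡ 1ℤ → tr A ≈[ N ] 0ℤ
det-I⊕⋆≡1⇒tr≈0 {N} A N≢0 det≡1 with ℤ.i*j≡0⇒i≡0∨j≡0 N N[tr+Ndet]≡0
  where
    N[tr+Ndet]≡0 : N * (tr A + N * det A) ≡ 0ℤ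
    N[tr+Ndet]≡0 = trans (sym (det-I⊕⋆ N A)) (cong (λ δ → δ - 1ℤ) det≡1)
... | inj₁ N≡0 = ⊥-elim (N≢0 N≡0)
... | inj₂ tr+Ndet≡0 = - det A , lemma (tr A) (det A) N tr+Ndet≡0
  where
    lemma : ∀ t δ N → t + N * δ ≡ 0ℤ → t ≡ 0ℤ + - δ * N
    lemma t δ N eq = begin
      t                    ≡⟨ l₁ t δ N ⟩
      (t + N * δ) - N * δ  ≡⟨ cong (λ s → s - N * δ) eq ⟩
      0ℤ - N * δ           ≡⟨ l₂ δ N ⟩
      0ℤ + - δ * N         ∎
      where
        open ≡-Reasoning
        l₁ : ∀ t δ N → t ≡ (t + N * δ) - N * δ
        l₁ = solve-∀
        l₂ : ∀ δ N → 0ℤ - N * δ ≡ 0ℤ + - δ * N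
        l₂ = solve-∀

I⊕⋆-cong : ∀ {N A B} → A ≈ₘ[ N ] B → I₂ ⊕ (N ⋆ A) ≈ₘ[ N * N ] I₂ ⊕ (N ⋆ B)
I⊕⋆-cong {N} {mat _ _ _ _} {mat _ _ _ _} (entrywise a≈ b≈ c≈ d≈) =
  entrywise (scale 1ℤ a≈) (scale 0ℤ b≈) (scale 0ℤ c≈) (scale 1ℤ d≈)
  where
    scale : ∀ u {x y} → x ≈[ N ] y → u + N * x ≈[ N * N ] u + N * y
    scale u (q , refl) = q , lemma u _ q N
      where lemma : ∀ u y q N → u + N * (y + q * N) ≡ u + N * y + q * (N * N)
            lemma = solve-∀

I⊕⋆-zeroM : ∀ N → I₂ ⊕ (N ⋆ zeroM) ≡ I₂
I⊕⋆-zeroM N = cong (λ z → I₂ ⊕ z) (⋆-zeroʳ N)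

IncongruentFamily : (Mat → Set) → ℕ → ℕ → Set
IncongruentFamily Γ N m =
  Σ (Fin m → Mat) λ γ → (∀ i → Γ (γ i)) × (∀ i j → γ i ≈ₘ[ + N ] γ j → i ≡ j)

module _ {p : ℕ} {Γ : Mat → Set} where

  family⇒CardGAtLeast : ∀ {s m} → IncongruentFamily Γ (p ^ s) m → CardGAtLeast p Γ s m
  family⇒CardGAtLeast (γ , γ∈Γ , γ-injective) =
    γ , (λ i → γ i , γ∈Γ i , ≈ₘ⇒≡ₘ[] (≈ₘ-refl {g = γ i})) , λ i j γi≡γj → γ-injective i j (≡ₘ[]⇒≈ₘ γi≡γj)

module _ {p : ℕ} (p-prime : Prime p) {Γ : Mat → Set} (Γ-subgroup : IsSubgroupSL2 Γ) where
  open PrimeModulus p-prime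
  open IsSubgroupSL2 Γ-subgroup

  private
    +p≢0 : + p ≢ 0ℤ
    +p≢0 eq = ℕ.≢-nonZero⁻¹ p (ℤ.+-injective eq)

    +p^1≡+p : + (p ^ 1) ≡ + p
    +p^1≡+p = cong +_ (ℕ.*-identityʳ p)

    +p^2≡+p*+p : + (p ^ 2) ≡ + p * + p
    +p^2≡+p*+p = trans (cong +_ (cong (p ℕ.*_) (ℕ.*-identityʳ p))) (ℤ.pos-* p p)

  adj·-closed : ∀ {g h} → Γ g → Γ h → Γ (adj g · h)
  adj·-closed {g} g∈Γ h∈Γ = mul _ _ (inv g g∈Γ) h∈Γ

  adj-cancelˡ : ∀ {N γ g h} → Γ γ → adj γ · g ≈ₘ[ N ] adj γ · h → g ≈ₘ[ N ] h
  adj-cancelˡ {γ = γ} γ∈Γ = ·-cancelˡ (adj γ) (≈-reflexive (trans (det-adj γ) (⊆SL2 γ γ∈Γ)))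

  congruent⇒V : ∀ {γ γ′} → Γ γ → Γ γ′ → γ ≈ₘ[ + p ] γ′ →
                Σ Mat λ A → InV p Γ 1 A × adj γ · γ′ ≡ I₂ ⊕ ((+ p) ⋆ A)
  congruent⇒V {γ} {γ′} γ∈Γ γ′∈Γ γ≈γ′ = A , (tr≈0 , adj γ · γ′ , δ∈Γ , δ≡ₘ) , δ≡
    where
      δ∈Γ : Γ (adj γ · γ′)
      δ∈Γ = adj·-closed γ∈Γ γ′∈Γ
      δ≈I : adj γ · γ′ ≈ₘ[ + p ] I₂
      δ≈I = ≈ₘ-trans (·-cong (≈ₘ-refl {g = adj γ}) (≈ₘ-sym γ≈γ′))
                     (adj-inverseˡ γ (≈-reflexive (⊆SL2 γ γ∈Γ)))
      A : Mat
      A = proj₁ (lift-≈I δ≈I)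
      δ≡ : adj γ · γ′ ≡ I₂ ⊕ ((+ p) ⋆ A)
      δ≡ = proj₂ (lift-≈I δ≈I)
      tr≈0 : tr A ≡[ p ] 0ℤ
      tr≈0 = ≈⇒≡[] {p} {tr A} {0ℤ} (det-I⊕⋆≡1⇒tr≈0 A +p≢0 (trans (cong det (sym δ≡)) (⊆SL2 _ δ∈Γ)))
      δ≡ₘ : (adj γ · γ′) ≡ₘ[ p ^ 2 ] (I₂ ⊕ ((+ (p ^ 1)) ⋆ A))
      δ≡ₘ = ≈ₘ⇒≡ₘ[] (≈ₘ-reflexive (trans δ≡ (cong (λ N → I₂ ⊕ (N ⋆ A)) (sym +p^1≡+p))))

  V-separates : ∀ {γ γ′ γ″ A B} → Γ γ →
                adj γ · γ′ ≡ I₂ ⊕ ((+ p) ⋆ A) → adj γ · γ″ ≡ I₂ ⊕ ((+ p) ⋆ B) →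
                A ≈ₘ[ + p ] B → γ′ ≈ₘ[ + (p ^ 2) ] γ″
  V-separates {γ} {γ′} {γ″} {A} {B} γ∈Γ δ′≡ δ″≡ A≈B =
    subst (γ′ ≈ₘ[_] γ″) (sym +p^2≡+p*+p) (adj-cancelˡ γ∈Γ (begin
      adj γ · γ′        ≡⟨ δ′≡ ⟩
      I₂ ⊕ ((+ p) ⋆ A)  ≈⟨ I⊕⋆-cong A≈B ⟩
      I₂ ⊕ ((+ p) ⋆ B)  ≡⟨ δ″≡ ⟨
      adj γ · γ″        ∎))
    where open ≈ₘ-Reasoning (+ p * + p)

  V₁-nonzero : ∀ {m} → p ℕ.* (p ℕ.* p) ℕ.< m → IncongruentFamily Γ (p ^ 2) m → VNonzero p Γ 1
  V₁-nonzero p³<m (γ , γ∈Γ , γ-injective) = from-collision (Fin.pigeonhole p³<m (encode p-prime ∘ γ))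
    where
      from-collision : (∃₂ λ i j → i Fin.< j × encode p-prime (γ i) ≡ encode p-prime (γ j)) → VNonzero p Γ 1
      from-collision (i , j , i<j , codeᵢ≡codeⱼ) = A , A∈V , A≢0
        where
          det≈1 : ∀ k → det (γ k) ≈[ + p ] 1ℤ
          det≈1 k = ≈-reflexive (⊆SL2 _ (γ∈Γ k))
          γᵢ≈γⱼ : γ i ≈ₘ[ + p ] γ j
          γᵢ≈γⱼ = encode-injective p-prime (γ i) (γ j) (det≈1 i) (det≈1 j) codeᵢ≡codeⱼ
          V : Σ Mat λ A → InV p Γ 1 A × adj (γ i) · γ j ≡ I₂ ⊕ ((+ p) ⋆ A)
          V = congruent⇒V (γ∈Γ i) (γ∈Γ j) γᵢ≈γⱼ
          A : Mat
          A = proj₁ V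
          A∈V : InV p Γ 1 A
          A∈V = proj₁ (proj₂ V)
          δ₀≡ : adj (γ i) · γ i ≡ I₂ ⊕ ((+ p) ⋆ zeroM)
          δ₀≡ = trans (adj-·-self (γ i)) (trans (cong scalar (⊆SL2 _ (γ∈Γ i))) (sym (I⊕⋆-zeroM (+ p))))
          A≢0 : ¬ A ≡ₘ[ p ] zeroM
          A≢0 A≡0 = Fin.<⇒≢ i<j (γ-injective i j
            (V-separates (γ∈Γ i) δ₀≡ (proj₂ (proj₂ V)) (≈ₘ-sym (≡ₘ[]⇒≈ₘ {g = A} A≡0))))

  coset-representative : ∀ {s w w′ γ γ′} → det w′ ≈[ + (p ^ s) ] 1ℤ → Γ γ → Γ γ′ →
                         w · γ ≈ₘ[ + (p ^ s) ] w′ · γ′ → InG p Γ s (adj w′ · w)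
  coset-representative {s} {w} {w′} {γ} {γ′} det≈1 γ∈Γ γ′∈Γ wγ≈w′γ′ =
    γ′ · adj γ , mul _ _ γ′∈Γ (inv γ γ∈Γ) , ≈ₘ⇒≡ₘ[] (≈ₘ-sym (begin
      adj w′ · w                      ≡⟨ ·-identityʳ _ ⟨
      (adj w′ · w) · I₂               ≡⟨ cong ((adj w′ · w) ·_) γ·adjγ≡I ⟨
      (adj w′ · w) · (γ · adj γ)      ≡⟨ reassoc (adj w′) w γ (adj γ) ⟩
      adj w′ · ((w · γ) · adj γ)      ≈⟨ ·-cong (≈ₘ-refl {g = adj w′}) (·-cong wγ≈w′γ′ (≈ₘ-refl {g = adj γ})) ⟩
      adj w′ · ((w′ · γ′) · adj γ)    ≡⟨ reassoc (adj w′) w′ γ′ (adj γ) ⟨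
      (adj w′ · w′) · (γ′ · adj γ)    ≈⟨ ·-cong (adj-inverseˡ w′ det≈1) (≈ₘ-refl {g = γ′ · adj γ}) ⟩
      I₂ · (γ′ · adj γ)               ≡⟨ ·-identityˡ _ ⟩
      γ′ · adj γ                      ∎))
    where
      open ≈ₘ-Reasoning (+ (p ^ s))
      γ·adjγ≡I : γ · adj γ ≡ I₂
      γ·adjγ≡I = trans (·-adj-self γ) (cong scalar (⊆SL2 γ γ∈Γ))
      reassoc : ∀ a b c d → (a · b) · (c · d) ≡ a · ((b · c) · d)
      reassoc a b c d = trans (·-assoc a b (c · d)) (cong (a ·_) (sym (·-assoc b c d)))

  InG-adj-swap : ∀ {s x y} → InG p Γ s (adj y · x) → InG p Γ s (adj x · y)
  InG-adj-swap {s} {x} {y} (g , g∈Γ , g≡) = adj g , inv g g∈Γ , ≈ₘ⇒≡ₘ[] (begin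
    adj g                  ≈⟨ adj-cong (≡ₘ[]⇒≈ₘ {g = g} {h = adj y · x} g≡) ⟩
    adj (adj y · x)        ≡⟨ adj-· (adj y) x ⟩
    adj x · adj (adj y)    ≡⟨ cong (adj x ·_) (adj-involutive y) ⟩
    adj x · y              ∎)
    where open ≈ₘ-Reasoning (+ (p ^ s))

  module _ {c : ℕ} (w : Fin c → Mat) (det-w≈1 : ∀ k → det (w k) ≈[ + p ] 1ℤ)
           (cosets-distinct : ∀ k l → InG p Γ 1 (adj (w l) · w k) → k ≡ l) where

    translates-congruent : ∀ {k l γ γ′} → Γ γ → Γ γ′ → w k · γ ≈ₘ[ + p ] w l · γ′ →
                           k ≡ l × γ ≈ₘ[ + p ] γ′
    translates-congruent {k} {l} {γ} {γ′} γ∈Γ γ′∈Γ wγ≈wγ′ =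
      k≡l , ·-cancelˡ (w l) (det-w≈1 l) (subst (λ k → w k · γ ≈ₘ[ + p ] w l · γ′) k≡l wγ≈wγ′)
      where
        k≡l : k ≡ l
        k≡l = cosets-distinct k l (coset-representative {1} {w k} {w l} {γ} {γ′}
                (subst (det (w l) ≈[_] 1ℤ) (sym +p^1≡+p) (det-w≈1 l)) γ∈Γ γ′∈Γ
                (subst (w k · γ ≈ₘ[_] w l · γ′) (sym +p^1≡+p) wγ≈wγ′))

    V₁-dim≥2 : ∀ {m} → p ℕ.* (p ℕ.* p) ℕ.* p ℕ.< c ℕ.* m → IncongruentFamily Γ (p ^ 2) m →
               DimVAtLeast2 p Γ 1
    V₁-dim≥2 {m} p⁴<cm (γ , γ∈Γ , γ-injective) =
      from-fibre (fibre-pigeonhole (p ℕ.* (p ℕ.* p)) p p⁴<cm (encode p-prime ∘ M))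
      where
        index : Fin (c ℕ.* m) ↣ (Fin c × Fin m)
        index = ↔⇒↣ Fin.*↔×
        coset : Fin (c ℕ.* m) → Fin c
        coset t = proj₁ (to index t)
        member : Fin (c ℕ.* m) → Fin m
        member t = proj₂ (to index t)
        M : Fin (c ℕ.* m) → Mat
        M t = w (coset t) · γ (member t)
        det-M≈1 : ∀ t → det (M t) ≈[ + p ] 1ℤ
        det-M≈1 t = ≈-trans (≈-reflexive (det-· (w (coset t)) (γ (member t))))
                            (*-cong (det-w≈1 (coset t)) (≈-reflexive (⊆SL2 _ (γ∈Γ (member t)))))
        from-fibre : (∃ λ v → Σ (Fin (ℕ.suc p) ↣ Fin (c ℕ.* m)) λ e →
                        ∀ r → encode p-prime (M (to e r)) ≡ v) → DimVAtLeast2 p Γ 1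
        from-fibre (v , e , code≡v) = finish (two-independent p-prime C C-injective)
          where
            k : Fin (ℕ.suc p) → Fin c
            k r = coset (to e r)
            i : Fin (ℕ.suc p) → Fin m
            i r = member (to e r)
            translate : ∀ r → k zero ≡ k r × γ (i zero) ≈ₘ[ + p ] γ (i r)
            translate r = translates-congruent {k zero} {k r} {γ (i zero)} {γ (i r)} (γ∈Γ (i zero)) (γ∈Γ (i r))
              (encode-injective p-prime (M (to e zero)) (M (to e r))
                 (det-M≈1 (to e zero)) (det-M≈1 (to e r)) (trans (code≡v zero) (sym (code≡v r))))
            V : ∀ r → Σ Mat λ A → InV p Γ 1 A × adj (γ (i zero)) · γ (i r) ≡ I₂ ⊕ ((+ p) ⋆ A)
            V r = congruent⇒V {γ (i zero)} {γ (i r)} (γ∈Γ (i zero)) (γ∈Γ (i r)) (proj₂ (translate r))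
            C : Fin (ℕ.suc p) → Mat
            C r = proj₁ (V r)
            C-injective : ∀ r s → C r ≈ₘ[ + p ] C s → r ≡ s
            C-injective r s Cr≈Cs = injective e (injective index (cong₂ _,_
              (trans (sym (proj₁ (translate r))) (proj₁ (translate s)))
              (γ-injective (i r) (i s) (V-separates {γ (i zero)} {γ (i r)} {γ (i s)} {C r} {C s}
                 (γ∈Γ (i zero)) (proj₂ (proj₂ (V r))) (proj₂ (proj₂ (V s))) Cr≈Cs))))
            finish : (∃₂ λ r s → LinearlyIndependent p (C r) (C s)) → DimVAtLeast2 p Γ 1
            finish (r , s , independent) = C r , C s , proj₁ (proj₂ (V r)) , proj₁ (proj₂ (V s)) , independent

-- Cusps

act-· : ∀ g h x y → act (g · h) x y ≡ uncurry (act g) (act h x y)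
act-· (mat a b c d) (mat e f g h) x y = cong₂ _,_ (lemma a b e f g h x y) (lemma c d e f g h x y)
  where lemma : ∀ a b e f g h x y → (a * e + b * g) * x + (a * f + b * h) * y ≡ a * (e * x + f * y) + b * (g * x + h * y)
        lemma = solve-∀

act-I₂ : ∀ x y → act I₂ x y ≡ (x , y)
act-I₂ x y = cong₂ _,_ (lemma₁ x y) (lemma₂ x y)
  where lemma₁ : ∀ x y → 1ℤ * x + 0ℤ * y ≡ x
        lemma₁ = solve-∀
        lemma₂ : ∀ x y → 0ℤ * x + 1ℤ * y ≡ y
        lemma₂ = solve-∀

act--I₂ : ∀ x y → act -I₂ x y ≡ (- x , - y)
act--I₂ x y = cong₂ _,_ (lemma₁ x y) (lemma₂ x y)
  where lemma₁ : ∀ x y → - 1ℤ * x + 0ℤ * y ≡ - x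
        lemma₁ = solve-∀
        lemma₂ : ∀ x y → 0ℤ * x + - 1ℤ * y ≡ - y
        lemma₂ = solve-∀

act-cong : ∀ {N g h} x y → g ≈ₘ[ N ] h →
           proj₁ (act g x y) ≈[ N ] proj₁ (act h x y) × proj₂ (act g x y) ≈[ N ] proj₂ (act h x y)
act-cong {g = mat _ _ _ _} {mat _ _ _ _} x y (entrywise a≈ b≈ c≈ d≈) =
  +-cong (*-cong a≈ (≈-refl {x = x})) (*-cong b≈ (≈-refl {x = y})) ,
  +-cong (*-cong c≈ (≈-refl {x = x})) (*-cong d≈ (≈-refl {x = y}))

module _ {Γ : Mat → Set} (Γ-subgroup : IsSubgroupSL2 Γ) where
  open IsSubgroupSL2 Γ-subgroup

  act-adj : ∀ {g x y U} → Γ g → act g x y ≡ U → uncurry (act (adj g)) U ≡ (x , y)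
  act-adj {g} {x} {y} g∈Γ refl = begin
    uncurry (act (adj g)) (act g x y)  ≡⟨ act-· (adj g) g x y ⟨
    act (adj g · g) x y                ≡⟨ cong (λ h → act h x y) (trans (adj-·-self g) (cong scalar (⊆SL2 g g∈Γ))) ⟩
    act I₂ x y                         ≡⟨ act-I₂ x y ⟩
    (x , y)                            ∎
    where open ≡-Reasoning

  module _ (-I₂∈Γ : Γ -I₂) where

    CuspEquiv⇒maps-to : ∀ {v u} → CuspEquiv Γ v u →
                        ∃ λ g → Γ g × act g (num v) (den v) ≡ (num u , den u)
    CuspEquiv⇒maps-to (g , g∈Γ , inj₁ gv≡u) = g , g∈Γ , gv≡u
    CuspEquiv⇒maps-to {v} {u} (g , g∈Γ , inj₂ gv≡-u) = -I₂ · g , mul _ _ -I₂∈Γ g∈Γ , (begin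
      act (-I₂ · g) (num v) (den v)               ≡⟨ act-· -I₂ g (num v) (den v) ⟩
      uncurry (act -I₂) (act g (num v) (den v))   ≡⟨ cong (uncurry (act -I₂)) gv≡-u ⟩
      act -I₂ (- num u) (- den u)                 ≡⟨ act--I₂ (- num u) (- den u) ⟩
      (- - num u , - - den u)                     ≡⟨ cong₂ _,_ (ℤ.neg-involutive (num u)) (ℤ.neg-involutive (den u)) ⟩
      (num u , den u)                             ∎)
      where open ≡-Reasoning

    orbit-family : ∀ {N m u} (v : Fin m → Cusp) →
                   (∀ s t → num (v s) ≈[ + N ] num (v t) → den (v s) ≈[ + N ] den (v t) → s ≡ t) →
                   (∀ t → CuspEquiv Γ (v t) u) → IncongruentFamily Γ N m
    orbit-family {N} {m} {u} v v-injective v~u = g , g∈Γ , g-injective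
      where
        g : Fin m → Mat
        g t = proj₁ (CuspEquiv⇒maps-to {v t} {u} (v~u t))
        g∈Γ : ∀ t → Γ (g t)
        g∈Γ t = proj₁ (proj₂ (CuspEquiv⇒maps-to {v t} {u} (v~u t)))
        back : ∀ t → uncurry (act (adj (g t))) (num u , den u) ≡ (num (v t) , den (v t))
        back t = act-adj (g∈Γ t) (proj₂ (proj₂ (CuspEquiv⇒maps-to {v t} {u} (v~u t))))
        g-injective : ∀ s t → g s ≈ₘ[ + N ] g t → s ≡ t
        g-injective s t gs≈gt = v-injective s t
          (subst₂ _≈[ + N ]_ (cong proj₁ (back s)) (cong proj₁ (back t)) (proj₁ adj-gu≈))
          (subst₂ _≈[ + N ]_ (cong proj₂ (back s)) (cong proj₂ (back t)) (proj₂ adj-gu≈))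
          where
            adj-gu≈ : proj₁ (act (adj (g s)) (num u) (den u)) ≈[ + N ] proj₁ (act (adj (g t)) (num u) (den u))
                    × proj₂ (act (adj (g s)) (num u) (den u)) ≈[ + N ] proj₂ (act (adj (g t)) (num u) (den u))
            adj-gu≈ = act-cong (num u) (den u) (adj-cong {g = g s} {g t} gs≈gt)

bézout⇒gcd≡1 : ∀ {x y} α β → α * x + β * y ≡ 1ℤ → ℤ.gcd x y ≡ 1ℤ
bézout⇒gcd≡1 {x} {y} α β eq = cong +_ (ℕ.∣1⇒≡1 (Signed.∣⇒∣ᵤ g∣1))
  where
    g∣1 : ℤ.gcd x y Signed.∣ 1ℤ
    g∣1 = subst (ℤ.gcd x y Signed.∣_) eq
      (Signed.∣m∣n⇒∣m+n (Signed.∣n⇒∣m*n α (Signed.∣ᵤ⇒∣ (ℤ.gcd[i,j]∣i x y)))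
                        (Signed.∣n⇒∣m*n β (Signed.∣ᵤ⇒∣ (ℤ.gcd[i,j]∣j x y))))

module PrimitiveVectors {p : ℕ} (p-prime : Prime p) where
  open PrimeModulus p-prime

  private
    pos-p² : + (p ℕ.* p) ≡ + p * + p
    pos-p² = ℤ.pos-* p p

  Fin-≈-unique : ∀ {i j : Fin p} → + toℕ i ≈[ + p ] + toℕ j → i ≡ j
  Fin-≈-unique {i} {j} i≈j = Fin.toℕ-injective (small-≈-unique (Fin.toℕ<n i) (Fin.toℕ<n j) i≈j)

  Fin-≈-unique² : ∀ {i j : Fin (p ℕ.* p)} → + toℕ i ≈[ + p * + p ] + toℕ j → i ≡ j
  Fin-≈-unique² {i} {j} i≈j = Fin.toℕ-injective
    (small-≈-unique (Fin.toℕ<n i) (Fin.toℕ<n j) (subst (+ toℕ i ≈[_] + toℕ j) (sym pos-p²) i≈j))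

  *p-cancel : ∀ {s x y} → s + x * + p ≈[ + p * + p ] s + y * + p → x ≈[ + p ] y
  *p-cancel {s} {x} {y} (k , eq) =
    k , ℤ.*-cancelʳ-≡ x (y + k * + p) (+ p) {{p-nonZero}} (trans (l₁ s x (+ p)) (trans (cong (λ z → z - s) eq) (l₂ s y k (+ p))))
    where
      l₁ : ∀ s x P → x * P ≡ (s + x * P) - s
      l₁ = solve-∀
      l₂ : ∀ s y k P → (s + y * P + k * (P * P)) - s ≡ (y + k * P) * P
      l₂ = solve-∀

  -- The residues modulo p² prime to p, as (r + 1) + q p with q < p and r < p - 1.
  unit : Fin p → Fin (ℕ.pred p) → ℤ
  unit q r = + ℕ.suc (toℕ r) + + toℕ q * + p

  private
    1+r<p : ∀ (r : Fin (ℕ.pred p)) → ℕ.suc (toℕ r) ℕ.< p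
    1+r<p r = subst (ℕ.suc (toℕ r) ℕ.<_) (ℕ.suc-pred p) (ℕ.s≤s (Fin.toℕ<n r))

    unit≈1+r : ∀ q r → unit q r ≈[ + p ] + ℕ.suc (toℕ r)
    unit≈1+r q r = + toℕ q , refl

  unit≉0 : ∀ q r → ¬ unit q r ≈[ + p ] 0ℤ
  unit≉0 q r u≈0 = ℕ.1+n≢0
    (small-≈-unique (1+r<p r) (ℕ.<-trans ℕ.0<1+n (1+r<p r)) (≈-trans (≈-sym (unit≈1+r q r)) u≈0))

  unit-injective : ∀ {q r q′ r′} → unit q r ≈[ + p * + p ] unit q′ r′ → q ≡ q′ × r ≡ r′
  unit-injective {q} {r} {q′} {r′} u≈u′ with r≡r′
    where
      r≡r′ : r ≡ r′
      r≡r′ = Fin.toℕ-injective (ℕ.suc-injective (small-≈-unique (1+r<p r) (1+r<p r′)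
               (≈-trans (≈-sym (unit≈1+r q r)) (≈-trans (≈-weaken {+ p} u≈u′) (unit≈1+r q′ r′)))))
  ... | refl = Fin-≈-unique (*p-cancel {+ ℕ.suc (toℕ r)} u≈u′) , refl

  -- Abstract for the same reason as ≉0⇒invertible.
  abstract
    inverse : Fin p → Fin (ℕ.pred p) → ℤ
    inverse q r = proj₁ (≉0⇒invertible (unit≉0 q r))

    inverse-unit≈1 : ∀ q r → inverse q r * unit q r ≈[ + p ] 1ℤ
    inverse-unit≈1 q r = proj₂ (≉0⇒invertible (unit≉0 q r))

  vecA : Fin p × Fin (ℕ.pred p) × Fin (p ℕ.* p) → ℤ × ℤ
  vecA (q , r , j) = unit q r , 1ℤ + + toℕ j * unit q r

  -- The first coordinate is 1 - w u + t u p with w u ≡ 1 (mod p): divisible by p, and t is read off mod p².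
  vecB : Fin p × Fin (ℕ.pred p) × Fin p → ℤ × ℤ
  vecB (q , r , t) = 1ℤ + (+ toℕ t * + p - inverse q r) * unit q r , unit q r

  private
    vecB₁-split : ∀ q r t → proj₁ (vecB (q , r , t)) ≡ (1ℤ - inverse q r * unit q r) + (+ toℕ t * unit q r) * + p
    vecB₁-split q r t = lemma (+ toℕ t) (+ p) (inverse q r) (unit q r)
      where lemma : ∀ t P w u → 1ℤ + (t * P - w) * u ≡ (1ℤ - w * u) + (t * u) * P
            lemma = solve-∀

    vecB₁≈0 : ∀ q r t → proj₁ (vecB (q , r , t)) ≈[ + p ] 0ℤ
    vecB₁≈0 q r t = begin
      proj₁ (vecB (q , r , t))                                    ≡⟨ vecB₁-split q r t ⟩
      (1ℤ - inverse q r * unit q r) + (+ toℕ t * unit q r) * + p  ≈⟨ +-cong (−-cong (≈-refl {x = 1ℤ}) (inverse-unit≈1 q r))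
                                                                             (*N≈0 (+ toℕ t * unit q r)) ⟩
      0ℤ                                                          ∎
      where open ≈-Reasoning (+ p)

    1+ju-cancel : ∀ {N u j j′} → 1ℤ + j * u ≈[ N ] 1ℤ + j′ * u → u * j ≈[ N ] u * j′
    1+ju-cancel {N} {u} {j} {j′} eq = begin
      u * j                        ≡⟨ lemma u j ⟩
      (1ℤ + j * u) - 1ℤ            ≈⟨ −-cong eq (≈-refl {x = 1ℤ}) ⟩
      (1ℤ + j′ * u) - 1ℤ           ≡⟨ lemma u j′ ⟨
      u * j′                       ∎
      where
        open ≈-Reasoning N
        lemma : ∀ u j → u * j ≡ (1ℤ + j * u) - 1ℤ
        lemma = solve-∀

  vecA-injective : ∀ a a′ → proj₁ (vecA a) ≈[ + p * + p ] proj₁ (vecA a′) →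
                   proj₂ (vecA a) ≈[ + p * + p ] proj₂ (vecA a′) → a ≡ a′
  vecA-injective (q , r , j) (q′ , r′ , j′) x≈x′ y≈y′ with unit-injective {q} {r} {q′} {r′} x≈x′
  ... | refl , refl = cong (λ j → q , r , j) (Fin-≈-unique² (invertible-cancelˡ {w = w} {unit q r} wu≈1 (1+ju-cancel {+ p * + p} {unit q r} {+ toℕ j} {+ toℕ j′} y≈y′)))
    where
      w : ℤ
      w = proj₁ (≉0⇒invertible-mod-p² (unit≉0 q r))
      wu≈1 : w * unit q r ≈[ + p * + p ] 1ℤ
      wu≈1 = proj₂ (≉0⇒invertible-mod-p² (unit≉0 q r))

  vecB-injective : ∀ b b′ → proj₁ (vecB b) ≈[ + p * + p ] proj₁ (vecB b′) →
                   proj₂ (vecB b) ≈[ + p * + p ] proj₂ (vecB b′) → b ≡ b′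
  vecB-injective (q , r , t) (q′ , r′ , t′) x≈x′ y≈y′ with unit-injective {q} {r} {q′} {r′} y≈y′
  ... | refl , refl = cong (λ t → q , r , t) (Fin-≈-unique (*-cancelˡ-≈ (unit≉0 q r) (begin
    unit q r * + toℕ t     ≡⟨ ℤ.*-comm (unit q r) (+ toℕ t) ⟩
    + toℕ t * unit q r     ≈⟨ *p-cancel {1ℤ - inverse q r * unit q r} {+ toℕ t * unit q r} {+ toℕ t′ * unit q r} (≈-trans (≈-reflexive (sym (vecB₁-split q r t))) (≈-trans x≈x′ (≈-reflexive (vecB₁-split q r t′)))) ⟩
    + toℕ t′ * unit q r    ≡⟨ ℤ.*-comm (+ toℕ t′) (unit q r) ⟩
    unit q r * + toℕ t′    ∎)))
    where open ≈-Reasoning (+ p)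

  vecA≉vecB : ∀ a b → ¬ proj₁ (vecA a) ≈[ + p * + p ] proj₁ (vecB b)
  vecA≉vecB (q , r , j) (q′ , r′ , t) x≈x′ = unit≉0 q r (≈-trans (≈-weaken {+ p} x≈x′) (vecB₁≈0 q′ r′ t))

  Index : Set
  Index = (Fin p × Fin (ℕ.pred p) × Fin (p ℕ.* p)) ⊎ (Fin p × Fin (ℕ.pred p) × Fin p)

  toCusp : Index → Cusp
  toCusp (inj₁ a@(q , r , j)) =
    cusp (proj₁ (vecA a)) (proj₂ (vecA a)) (bézout⇒gcd≡1 {unit q r} {proj₂ (vecA a)} (- + toℕ j) 1ℤ (lemma (+ toℕ j) (unit q r)))
    where lemma : ∀ j u → - j * u + 1ℤ * (1ℤ + j * u) ≡ 1ℤ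
          lemma = solve-∀
  toCusp (inj₂ b@(q , r , t)) =
    cusp (proj₁ (vecB b)) (proj₂ (vecB b)) (bézout⇒gcd≡1 {proj₁ (vecB b)} {unit q r} 1ℤ (- k) (lemma k (unit q r)))
    where k : ℤ
          k = + toℕ t * + p - inverse q r
          lemma : ∀ c u → 1ℤ * (1ℤ + c * u) + - c * u ≡ 1ℤ
          lemma = solve-∀

  toCusp-injective : ∀ x y → num (toCusp x) ≈[ + p * + p ] num (toCusp y) →
                     den (toCusp x) ≈[ + p * + p ] den (toCusp y) → x ≡ y
  toCusp-injective (inj₁ a) (inj₁ a′) x≈ y≈ = cong inj₁ (vecA-injective a a′ x≈ y≈)
  toCusp-injective (inj₁ a) (inj₂ b) x≈ _ = ⊥-elim (vecA≉vecB a b x≈)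
  toCusp-injective (inj₂ b) (inj₁ a) x≈ _ = ⊥-elim (vecA≉vecB a b (≈-sym x≈))
  toCusp-injective (inj₂ b) (inj₂ b′) x≈ y≈ = cong inj₂ (vecB-injective b b′ x≈ y≈)

  #Index : ℕ
  #Index = p ℕ.* (ℕ.pred p ℕ.* (p ℕ.* p)) ℕ.+ p ℕ.* (ℕ.pred p ℕ.* p)

  enumerate : Fin #Index ↔ Index
  enumerate = (((↔-id (Fin p) ×-↔ Fin.*↔×) ↔-∘ Fin.*↔×) ⊎-↔ ((↔-id (Fin p) ×-↔ Fin.*↔×) ↔-∘ Fin.*↔×)) ↔-∘ Fin.+↔⊎

  #Index≡ : #Index ≡ p ^ 4 ∸ p ^ 2
  #Index≡ = subst (λ n → n ℕ.* (ℕ.pred n ℕ.* (n ℕ.* n)) ℕ.+ n ℕ.* (ℕ.pred n ℕ.* n) ≡ n ^ 4 ∸ n ^ 2)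
                  (ℕ.suc-pred p) (count (ℕ.pred p))
    where
      expand : ∀ q → (1 ℕ.+ q) ℕ.* ((1 ℕ.+ q) ℕ.* ((1 ℕ.+ q) ℕ.* ((1 ℕ.+ q) ℕ.* 1))) ≡
                     ((1 ℕ.+ q) ℕ.* (q ℕ.* ((1 ℕ.+ q) ℕ.* (1 ℕ.+ q))) ℕ.+ (1 ℕ.+ q) ℕ.* (q ℕ.* (1 ℕ.+ q)))
                     ℕ.+ (1 ℕ.+ q) ℕ.* ((1 ℕ.+ q) ℕ.* 1)
      expand = ℕ.solve-∀
      count : ∀ q → ℕ.suc q ℕ.* (q ℕ.* (ℕ.suc q ℕ.* ℕ.suc q)) ℕ.+ ℕ.suc q ℕ.* (q ℕ.* ℕ.suc q) ≡ ℕ.suc q ^ 4 ∸ ℕ.suc q ^ 2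
      count q = sym (trans (cong (_∸ ℕ.suc q ^ 2) (expand q)) (ℕ.m+n∸n≡m _ (ℕ.suc q ^ 2)))

  primitive-family : Σ (Fin (p ^ 4 ∸ p ^ 2) → Cusp) λ v →
                     ∀ s t → num (v s) ≈[ + (p ^ 2) ] num (v t) → den (v s) ≈[ + (p ^ 2) ] den (v t) → s ≡ t
  primitive-family = subst Family #Index≡ (v , v-injective)
    where
      Family : ℕ → Set
      Family n = Σ (Fin n → Cusp) λ v →
                 ∀ s t → num (v s) ≈[ + (p ^ 2) ] num (v t) → den (v s) ≈[ + (p ^ 2) ] den (v t) → s ≡ t
      p^2≡ : + (p ^ 2) ≡ + p * + p
      p^2≡ = trans (cong (λ k → + (p ℕ.* k)) (ℕ.*-identityʳ p)) pos-p²
      index : Fin #Index ↣ Index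
      index = ↔⇒↣ enumerate
      v : Fin #Index → Cusp
      v s = toCusp (to index s)
      v-injective : ∀ s t → num (v s) ≈[ + (p ^ 2) ] num (v t) → den (v s) ≈[ + (p ^ 2) ] den (v t) → s ≡ t
      v-injective s t x≈ y≈ = injective index
        (toCusp-injective _ _ (subst (num (v s) ≈[_] num (v t)) p^2≡ x≈) (subst (den (v s) ≈[_] den (v t)) p^2≡ y≈))

-- Numerical bounds

n≤1+2[n/2] : ∀ n → n ≤ ℕ.suc (2 ℕ.* (n / 2))
n≤1+2[n/2] n = begin
  n                        ≡⟨ m≡m%n+[m/n]*n n 2 ⟩
  n ℕ.% 2 ℕ.+ (n / 2) ℕ.* 2 ≤⟨ ℕ.+-monoˡ-≤ ((n / 2) ℕ.* 2) (ℕ.≤-pred (m%n<n n 2)) ⟩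
  1 ℕ.+ (n / 2) ℕ.* 2      ≡⟨ cong ℕ.suc (ℕ.*-comm (n / 2) 2) ⟩
  ℕ.suc (2 ℕ.* (n / 2))      ∎
  where open ℕ.≤-Reasoning

<-*[n/2] : ∀ k a n → 2 ℕ.* a ℕ.+ ℕ.suc k ≤ k ℕ.* n → a < k ℕ.* (n / 2)
<-*[n/2] k a n 2a+1+k≤kn = ℕ.*-cancelˡ-< 2 a (k ℕ.* (n / 2)) (ℕ.+-cancelʳ-≤ k _ _ (begin
  ℕ.suc (2 ℕ.* a) ℕ.+ k          ≡⟨ ℕ.+-suc (2 ℕ.* a) k ⟨
  2 ℕ.* a ℕ.+ ℕ.suc k            ≤⟨ 2a+1+k≤kn ⟩
  k ℕ.* n                      ≤⟨ ℕ.*-monoʳ-≤ k (n≤1+2[n/2] n) ⟩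
  k ℕ.* ℕ.suc (2 ℕ.* (n / 2))    ≡⟨ lemma k (n / 2) ⟩
  2 ℕ.* (k ℕ.* (n / 2)) ℕ.+ k  ∎))
  where
    open ℕ.≤-Reasoning
    lemma : ∀ k h → k ℕ.* ℕ.suc (2 ℕ.* h) ≡ 2 ℕ.* (k ℕ.* h) ℕ.+ k
    lemma = ℕ.solve-∀

-- _^_ is opaque to the ring solver, so the powers are written out in the identities below.
p³<[p⁴∸p²]/2 : ∀ q → (3 ℕ.+ q) ℕ.* ((3 ℕ.+ q) ℕ.* (3 ℕ.+ q)) < ((3 ℕ.+ q) ^ 4 ∸ (3 ℕ.+ q) ^ 2) / 2
p³<[p⁴∸p²]/2 q = subst (p³ <_) (ℕ.*-identityˡ (((3 ℕ.+ q) ^ 4 ∸ (3 ℕ.+ q) ^ 2) / 2)) (<-*[n/2] 1 p³ ((3 ℕ.+ q) ^ 4 ∸ (3 ℕ.+ q) ^ 2) (begin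
  2 ℕ.* p³ ℕ.+ 2                                ≤⟨ ℕ.m≤m+n (2 ℕ.* p³ ℕ.+ 2) (rest q) ⟩
  2 ℕ.* p³ ℕ.+ 2 ℕ.+ rest q                     ≡⟨ ℕ.m+n∸m≡n ((3 ℕ.+ q) ^ 2) (2 ℕ.* p³ ℕ.+ 2 ℕ.+ rest q) ⟨
  (3 ℕ.+ q) ^ 2 ℕ.+ (2 ℕ.* p³ ℕ.+ 2 ℕ.+ rest q) ∸ (3 ℕ.+ q) ^ 2 ≡⟨ cong (_∸ (3 ℕ.+ q) ^ 2) (expand q) ⟨
  (3 ℕ.+ q) ^ 4 ∸ (3 ℕ.+ q) ^ 2                 ≡⟨ ℕ.*-identityˡ ((3 ℕ.+ q) ^ 4 ∸ (3 ℕ.+ q) ^ 2) ⟨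
  1 ℕ.* ((3 ℕ.+ q) ^ 4 ∸ (3 ℕ.+ q) ^ 2)         ∎))
  where
    open ℕ.≤-Reasoning
    p³ : ℕ
    p³ = (3 ℕ.+ q) ℕ.* ((3 ℕ.+ q) ℕ.* (3 ℕ.+ q))
    rest : ℕ → ℕ
    rest q = q ℕ.* q ℕ.* q ℕ.* q ℕ.+ 10 ℕ.* (q ℕ.* q ℕ.* q) ℕ.+ 35 ℕ.* (q ℕ.* q) ℕ.+ 48 ℕ.* q ℕ.+ 16
    expand : ∀ q → (3 ℕ.+ q) ℕ.* ((3 ℕ.+ q) ℕ.* ((3 ℕ.+ q) ℕ.* ((3 ℕ.+ q) ℕ.* 1))) ≡
                   (3 ℕ.+ q) ℕ.* ((3 ℕ.+ q) ℕ.* 1) ℕ.+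
                   (2 ℕ.* ((3 ℕ.+ q) ℕ.* ((3 ℕ.+ q) ℕ.* (3 ℕ.+ q))) ℕ.+ 2 ℕ.+
                    (q ℕ.* q ℕ.* q ℕ.* q ℕ.+ 10 ℕ.* (q ℕ.* q ℕ.* q) ℕ.+ 35 ℕ.* (q ℕ.* q) ℕ.+ 48 ℕ.* q ℕ.+ 16))
    expand = ℕ.solve-∀

p⁴<3[p⁴∸p²]/2 : ∀ q → (2 ℕ.+ q) ℕ.* ((2 ℕ.+ q) ℕ.* (2 ℕ.+ q)) ℕ.* (2 ℕ.+ q) < 3 ℕ.* (((2 ℕ.+ q) ^ 4 ∸ (2 ℕ.+ q) ^ 2) / 2)
p⁴<3[p⁴∸p²]/2 q = <-*[n/2] 3 p⁴ ((2 ℕ.+ q) ^ 4 ∸ (2 ℕ.+ q) ^ 2) (begin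
  2 ℕ.* p⁴ ℕ.+ 4                        ≤⟨ ℕ.m≤m+n (2 ℕ.* p⁴ ℕ.+ 4) (rest q) ⟩
  2 ℕ.* p⁴ ℕ.+ 4 ℕ.+ rest q             ≡⟨ triple q ⟩
  3 ℕ.* D                               ≡⟨ cong (3 ℕ.*_) (ℕ.m+n∸m≡n ((2 ℕ.+ q) ^ 2) D) ⟨
  3 ℕ.* ((2 ℕ.+ q) ^ 2 ℕ.+ D ∸ (2 ℕ.+ q) ^ 2) ≡⟨ cong (λ m → 3 ℕ.* (m ∸ (2 ℕ.+ q) ^ 2)) (expand q) ⟨
  3 ℕ.* ((2 ℕ.+ q) ^ 4 ∸ (2 ℕ.+ q) ^ 2) ∎)
  where
    open ℕ.≤-Reasoning
    p⁴ : ℕ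
    p⁴ = (2 ℕ.+ q) ℕ.* ((2 ℕ.+ q) ℕ.* (2 ℕ.+ q)) ℕ.* (2 ℕ.+ q)
    rest : ℕ → ℕ
    rest q = q ℕ.* q ℕ.* q ℕ.* q ℕ.+ 8 ℕ.* (q ℕ.* q ℕ.* q) ℕ.+ 21 ℕ.* (q ℕ.* q) ℕ.+ 20 ℕ.* q
    D : ℕ
    D = 2 ℕ.* ((2 ℕ.+ q) ℕ.* ((2 ℕ.+ q) ℕ.* 1)) ℕ.+ 4 ℕ.+ rest q
    expand : ∀ q → (2 ℕ.+ q) ℕ.* ((2 ℕ.+ q) ℕ.* ((2 ℕ.+ q) ℕ.* ((2 ℕ.+ q) ℕ.* 1))) ≡
                   (2 ℕ.+ q) ℕ.* ((2 ℕ.+ q) ℕ.* 1) ℕ.+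
                   (2 ℕ.* ((2 ℕ.+ q) ℕ.* ((2 ℕ.+ q) ℕ.* 1)) ℕ.+ 4 ℕ.+
                    (q ℕ.* q ℕ.* q ℕ.* q ℕ.+ 8 ℕ.* (q ℕ.* q ℕ.* q) ℕ.+ 21 ℕ.* (q ℕ.* q) ℕ.+ 20 ℕ.* q))
    expand = ℕ.solve-∀
    triple : ∀ q → 2 ℕ.* ((2 ℕ.+ q) ℕ.* ((2 ℕ.+ q) ℕ.* (2 ℕ.+ q)) ℕ.* (2 ℕ.+ q)) ℕ.+ 4 ℕ.+
                   (q ℕ.* q ℕ.* q ℕ.* q ℕ.+ 8 ℕ.* (q ℕ.* q ℕ.* q) ℕ.+ 21 ℕ.* (q ℕ.* q) ℕ.+ 20 ℕ.* q) ≡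
                   3 ℕ.* (2 ℕ.* ((2 ℕ.+ q) ℕ.* ((2 ℕ.+ q) ℕ.* 1)) ℕ.+ 4 ℕ.+
                   (q ℕ.* q ℕ.* q ℕ.* q ℕ.+ 8 ℕ.* (q ℕ.* q ℕ.* q) ℕ.+ 21 ℕ.* (q ℕ.* q) ℕ.+ 20 ℕ.* q))
    triple = ℕ.solve-∀

module _ {p : ℕ} (p-prime : Prime p) {Γ : Mat → Set} (Γ-subgroup : IsSubgroupSL2 Γ) (-I₂∈Γ : Γ -I₂) where

  large-family : AtMostTwoCusps Γ → IncongruentFamily Γ (p ^ 2) ((p ^ 4 ∸ p ^ 2) / 2)
  large-family (u₁ , u₂ , cover) with PrimitiveVectors.primitive-family p-prime
  ... | v , v-injective with homogeneous-half (p ^ 4 ∸ p ^ 2) (cover ∘ v)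
  ...   | e , inj₁ v~u₁ = orbit-family Γ-subgroup -I₂∈Γ {p ^ 2} {u = u₁} (v ∘ to e)
                            (λ s t x≈ y≈ → injective e (v-injective _ _ x≈ y≈)) v~u₁
  ...   | e , inj₂ v~u₂ = orbit-family Γ-subgroup -I₂∈Γ {p ^ 2} {u = u₂} (v ∘ to e)
                            (λ s t x≈ y≈ → injective e (v-injective _ _ x≈ y≈)) v~u₂

V₁-nonzero-at-2 : ∀ {Γ} → Γ -I₂ → VNonzero 2 Γ 1
V₁-nonzero-at-2 -I₂∈Γ = -I₂ , (≈⇒≡[] {2} {tr -I₂} {0ℤ} (- 1ℤ , refl) , -I₂ , -I₂∈Γ , ≈ₘ⇒≡ₘ[] (≈ₘ-refl {g = -I₂})) , -I₂≢0
  where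
    -I₂≢0 : ¬ -I₂ ≡ₘ[ 2 ] zeroM
    -I₂≢0 (2∣1 , _) with () ← ℕ.∣1⇒≡1 2∣1

module _ {p : ℕ} (p-prime : Prime p) {Γ : Mat → Set} (Γ-subgroup : IsSubgroupSL2 Γ) where

  index>2⇒three-cosets : IndexG1GreaterThan2 p Γ →
    Σ (Fin 3 → Mat) λ w → (∀ k → det (w k) ≈[ + p ] 1ℤ) × (∀ k l → InG p Γ 1 (adj (w l) · w k) → k ≡ l)
  index>2⇒three-cosets (x , y , z , det-x , det-y , det-z , x≁y , x≁z , y≁z) = w , det-w , distinct
    where
      w : Fin 3 → Mat
      w zero = x
      w (suc zero) = y
      w (suc (suc zero)) = z
      det-w : ∀ k → det (w k) ≈[ + p ] 1ℤ
      det-w zero = ≡[]⇒≈ det-x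
      det-w (suc zero) = ≡[]⇒≈ det-y
      det-w (suc (suc zero)) = ≡[]⇒≈ det-z
      swap : ∀ {x y} → InG p Γ 1 (adj y · x) → InG p Γ 1 (adj x · y)
      swap {x} {y} = InG-adj-swap p-prime Γ-subgroup {1} {x} {y}
      distinct : ∀ k l → InG p Γ 1 (adj (w l) · w k) → k ≡ l
      distinct zero zero _ = refl
      distinct zero (suc zero) h = ⊥-elim (x≁y (swap {x} {y} h))
      distinct zero (suc (suc zero)) h = ⊥-elim (x≁z (swap {x} {z} h))
      distinct (suc zero) zero h = ⊥-elim (x≁y h)
      distinct (suc zero) (suc zero) _ = refl
      distinct (suc zero) (suc (suc zero)) h = ⊥-elim (y≁z (swap {y} {z} h))
      distinct (suc (suc zero)) zero h = ⊥-elim (x≁z h)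
      distinct (suc (suc zero)) (suc zero) h = ⊥-elim (y≁z h)
      distinct (suc (suc zero)) (suc (suc zero)) _ = refl

V₁-nonzero-of-large-family : ∀ p {Γ} → Prime p → IsSubgroupSL2 Γ → Γ -I₂ →
                             IncongruentFamily Γ (p ^ 2) ((p ^ 4 ∸ p ^ 2) / 2) → VNonzero p Γ 1
V₁-nonzero-of-large-family 0 p-prime = ⊥-elim (¬prime[0] p-prime)
V₁-nonzero-of-large-family 1 p-prime = ⊥-elim (¬prime[1] p-prime)
V₁-nonzero-of-large-family 2 _ _ -I₂∈Γ _ = V₁-nonzero-at-2 -I₂∈Γ
V₁-nonzero-of-large-family (suc (suc (suc q))) p-prime Γ-subgroup _ family =
  V₁-nonzero p-prime Γ-subgroup (p³<[p⁴∸p²]/2 q) family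

V₁-dim≥2-of-large-family : ∀ p {Γ} → Prime p → IsSubgroupSL2 Γ →
                           IncongruentFamily Γ (p ^ 2) ((p ^ 4 ∸ p ^ 2) / 2) →
                           IndexG1GreaterThan2 p Γ → DimVAtLeast2 p Γ 1
V₁-dim≥2-of-large-family 0 p-prime = ⊥-elim (¬prime[0] p-prime)
V₁-dim≥2-of-large-family 1 p-prime = ⊥-elim (¬prime[1] p-prime)
V₁-dim≥2-of-large-family (suc (suc q)) p-prime Γ-subgroup family index>2
  with index>2⇒three-cosets p-prime Γ-subgroup index>2
... | w , det-w≈1 , cosets-distinct =
  V₁-dim≥2 p-prime Γ-subgroup w det-w≈1 cosets-distinct (p⁴<3[p⁴∸p²]/2 q) family

proposition4p5 : (p : ℕ) → Prime p → (Γ : Mat → Set) →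
    CongruenceOfPLevel p Γ → Γ -I₂ → AtMostTwoCusps Γ →
    (CardGAtLeast p Γ 2 (((p ^ 4) ∸ (p ^ 2)) / 2) × VNonzero p Γ 1)
    × (IndexG1GreaterThan2 p Γ → DimVAtLeast2 p Γ 1)
proposition4p5 p p-prime Γ (Γ-subgroup , _) -I₂∈Γ two-cusps =
  conclude (large-family p-prime Γ-subgroup -I₂∈Γ two-cusps)
  where
    conclude : IncongruentFamily Γ (p ^ 2) ((p ^ 4 ∸ p ^ 2) / 2) →
               (CardGAtLeast p Γ 2 ((p ^ 4 ∸ p ^ 2) / 2) × VNonzero p Γ 1) ×
               (IndexG1GreaterThan2 p Γ → DimVAtLeast2 p Γ 1)
    conclude family =
      (family⇒CardGAtLeast {p} {Γ} {2} family , V₁-nonzero-of-large-family p p-prime Γ-subgroup -I₂∈Γ family) ,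
      V₁-dim≥2-of-large-family p p-prime Γ-subgroup family
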